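{- Let $\alpha,\beta,u,v$ be complex numbers and $s=\sqrt{v^2-u^2}$. Then, as formal power series in $t$, $$\sum_{n\ge0}\Bigl(\sum_{\sigma\in\mathfrak S_{n+1}}u^{2{\rm M}(\sigma)}v^{n-2{\rm M}(\sigma)}\alpha^{{\rm LRmin}(\sigma)-1}\beta^{{\rm RLmin}(\sigma)-1}\Bigr)\frac{t^n}{n!}=\left(\frac{s}{s\cosh(ts)-v\sinh(ts)}\right)^{\alpha+\beta}.$$
   Context: $\mathfrak S_m$ is the set of permutations $\sigma=\sigma_1\cdots\sigma_m$ of $[m]$. ${\rm M}(\sigma)$ = number of interior peaks ($1<i<m$, $\sigma_{i-1}<\sigma_i>\sigma_{i+1}$); ${\rm LRmin}(\sigma)$ (resp. ${\rm RLmin}(\sigma)$) = number of entries smaller than all entries to their left (resp. right). The right side means $\bigl(\cosh(ts)-v\,\tfrac{\sinh(ts)}{s}\bigr)^{ -(\alpha+\beta)}$, where $\cosh(ts)=\sum_k s^{2k}t^{2k}/(2k)!$ and $\sinh(ts)/s=\sum_k s^{2k}t^{2k+1}/(2k+1)!$ are power series depending only on $s^2$; the bracket has constant term $1$ and its complex power is $\exp(-(\alpha+\beta)\log(\cdot))$. -}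

module Defs where

open import Data.Nat using (ℕ; zero; suc; _∸_; _<ᵇ_; _!)
  renaming (_+_ to _+ℕ_; _*_ to _*ℕ_)
open import Data.Bool using (Bool; true; false; if_then_else_; _∧_)
open import Data.List using (List; []; _∷_; map; concatMap)
open import Algebra.Bundles using (CommutativeRing)

-- Permutations of [m] = {1,…,m}, as one-line words σ₁⋯σₘ.
-- perms m lists every element of 𝔖_m exactly once (built by inserting
-- the largest letter m into every position of each permutation of [m-1]).

insertions : ℕ → List ℕ → List (List ℕ)
insertions x []       = (x ∷ []) ∷ []
insertions x (y ∷ ys) = (x ∷ y ∷ ys) ∷ map (y ∷_) (insertions x ys)

perms : ℕ → List (List ℕ)
perms zero    = [] ∷ []
perms (suc m) = concatMap (insertions (suc m)) (perms m)

allB : (ℕ → Bool) → List ℕ → Bool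
allB p []       = true
allB p (x ∷ xs) = p x ∧ allB p xs

b2n : Bool → ℕ
b2n true  = 1
b2n false = 0

peaks : List ℕ → ℕ
peaks (a ∷ b ∷ c ∷ rest) = b2n ((a <ᵇ b) ∧ (c <ᵇ b)) +ℕ peaks (b ∷ c ∷ rest)
peaks _                  = 0

lrminAux : List ℕ → List ℕ → ℕ
lrminAux seen []       = 0
lrminAux seen (x ∷ xs) = b2n (allB (λ y → x <ᵇ y) seen) +ℕ lrminAux (x ∷ seen) xs

LRmin : List ℕ → ℕ
LRmin σ = lrminAux [] σ

RLmin : List ℕ → ℕ
RLmin []       = 0
RLmin (x ∷ xs) = b2n (allB (λ y → x <ᵇ y) xs) +ℕ RLmin xs

-- Formal power series in t over a commutative ring R in which the
-- positive integers are invertible (inv n is meant to be 1/n; the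
-- relevant law is a hypothesis of the main theorem).

module Series {c ℓ} (R : CommutativeRing c ℓ) (inv : ℕ → CommutativeRing.Carrier R) where
  open CommutativeRing R

  pow : Carrier → ℕ → Carrier
  pow x zero    = 1#
  pow x (suc n) = x * pow x n

  ιℕ : ℕ → Carrier
  ιℕ zero    = 0#
  ιℕ (suc n) = 1# + ιℕ n

  sumTo : ℕ → (ℕ → Carrier) → Carrier
  sumTo zero    f = f 0
  sumTo (suc n) f = sumTo n f + f (suc n)

  sumList : List Carrier → Carrier
  sumList []       = 0#
  sumList (x ∷ xs) = x + sumList xs

  PS : Set c
  PS = ℕ → Carrier

  mulPS : PS → PS → PS
  mulPS f g n = sumTo n (λ k → f k * g (n ∸ k))

  powPS : PS → ℕ → PS
  powPS f zero    = one
    where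
      one : PS
      one zero    = 1#
      one (suc _) = 0#
  powPS f (suc k) = mulPS f (powPS f k)

  scalePS : Carrier → PS → PS
  scalePS a f n = a * f n

  dropConst : PS → PS
  dropConst f zero    = 0#
  dropConst f (suc n) = f (suc n)

  -- log G = Σ_{k≥1} (-1)^{k+1} (G-1)^k / k   (for G with constant term 1);
  -- the coefficient of t^n only involves k ≤ n.
  -- log G = Σ_{k≥1} (-1)^{k+1} (G-1)^k / k   (for G with constant term 1);
  -- since (G-1)^k = O(t^k), the coefficient of t^n only involves k ≤ n.
  logPS : PS → PS
  logPS G n = sumTo n (λ k → term k)
    where
      term : ℕ → Carrier
      term zero    = 0#
      term (suc k) = pow (- 1#) k * inv (suc k) * powPS (dropConst G) (suc k) n

  expPS : PS → PS
  expPS H n = sumTo n (λ k → inv (k !) * powPS (dropConst H) k n)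

  cpowPS : PS → Carrier → PS
  cpowPS G γ = expPS (scalePS γ (logPS G))

  -- The bracket  cosh(ts) - v sinh(ts)/s  as a series depending only on
  -- s² = v² - u²:  Σ_k s^{2k} t^{2k}/(2k)!  -  v Σ_k s^{2k} t^{2k+1}/(2k+1)!
  bracket : Carrier → Carrier → PS
  bracket u v n = go n
    where
      s2 : Carrier
      s2 = v * v - u * u
      half : ℕ → ℕ
      half zero          = 0
      half (suc zero)    = 0
      half (suc (suc m)) = suc (half m)
      isEven : ℕ → Bool
      isEven zero          = true
      isEven (suc zero)    = false
      isEven (suc (suc m)) = isEven m
      go : ℕ → Carrier
      go m = if isEven m then pow s2 (half m) * inv (m !)
                         else - (v * pow s2 (half m) * inv (m !))

  rhs : (α β u v : Carrier) → PS
  rhs α β u v = cpowPS (bracket u v) (- (α + β))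

  weight : (α β u v : Carrier) → ℕ → List ℕ → Carrier
  weight α β u v n σ =
    pow u (2 *ℕ peaks σ) * pow v (n ∸ 2 *ℕ peaks σ)
      * pow α (LRmin σ ∸ 1) * pow β (RLmin σ ∸ 1)

  lhs : (α β u v : Carrier) → PS
  lhs α β u v n = sumList (map (weight α β u v n) (perms (suc n))) * inv (n !)

-- Work in W = R[[w]] with X = v + w and Q = X² − s², where s² = v² − u², so that X and Q specialise
-- to v and u² at w = 0, and let D = Q d/dw, the derivation with D X = Q and D Q = 2 X Q.  Inserting the
-- new maximum into σ ∈ 𝔖_{n+1} multiplies the weight by α at the front and by β at the end (raising the
-- power of X), keeps the number of peaks in the 2M(σ) interior gaps next to a peak and raises it by one
-- in the other n − 2M(σ).  Hence P_n = Σ_σ α^(LRmin−1) β^(RLmin−1) Q^M X^(n−2M) satisfies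
-- P_{n+1} = (α+β) X P_n + D P_n, so F = Σ P_n tⁿ/n! ∈ W[[t]] satisfies ∂_t F = (α+β) X F + D F, while
-- G = cosh(ts) − X sinh(ts)/s satisfies ∂_t G = D G − X G.  Then E = G ∂_t F + (α+β) (∂_t G) F satisfies
-- ∂_t E = D E + (α+β−1) X E and E(0) = 0, so E = 0.  At w = 0 this says that the left-hand side y obeys
-- G y′ = −(α+β) G′ y, as does G^(−(α+β)) = exp(−(α+β) log G); both start with 1, so they coincide.

module Submission where

open import Defs
open import Data.Nat using (ℕ; suc)
open import Algebra.Bundles using (CommutativeRing)

open import Data.Nat using (zero; _∸_; _≤_; _<_; z≤n; s≤s; _<ᵇ_; _!) renaming (_+_ to _+ℕ_; _*_ to _*ℕ_)
import Data.Nat.Properties as ℕP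
open import Data.Integer.Base using (ℤ; +_; -[1+_]; _⊖_; sign; ∣_∣; _◃_)
import Data.Integer.Base as ℤ
import Data.Integer.Properties as ℤP
import Data.Sign.Base as Sign
open import Data.Bool using (Bool; true; false; _∧_; if_then_else_)
import Data.Bool.Properties as BoolP
open import Data.List using (List; []; _∷_; map; concatMap; _++_; length)
import Data.List.Properties as ListP
open import Data.List.Relation.Unary.All as All using (All; []; _∷_)
open import Data.List.Relation.Unary.All.Properties using (map⁺; concat⁺)
open import Data.Product using (Σ; ∃₂; _×_; _,_; proj₂)
open import Data.Sum using (inj₁; inj₂)
open import Data.Maybe using (just; nothing)
open import Level using (_⊔_)
open import Relation.Nullary using (yes; no)
open import Relation.Binary.Definitions using (WeaklyDecidable)
import Relation.Binary.PropositionalEquality as ≡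
open ≡ using (_≡_)
import Relation.Binary.Reasoning.Setoid as SetoidReasoning
import Algebra.Solver.Ring.AlmostCommutativeRing as ACR

-- Cancelling terms such as x − x requires deciding equality of coefficients, so the solver is run
-- with coefficients in ℤ, which maps into every commutative ring.
module IntegerSolver {c ℓ} (R : CommutativeRing c ℓ) where
  open CommutativeRing R
  open import Algebra.Properties.Ring ring using (-0#≈0#; -‿distribˡ-*; -‿distribʳ-*; -‿involutive)
  open import Algebra.Properties.AbelianGroup +-abelianGroup using (⁻¹-∙-comm)
  open import Algebra.Properties.CommutativeSemigroup +-commutativeSemigroup using (interchange)
  open SetoidReasoning setoid

  -- fromℕ 1 reduces to 1#, so that the constant (con (+ 1)) of a solved identity matches 1# in a goal.
  fromℕ : ℕ → Carrier
  fromℕ zero = 0#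
  fromℕ (suc zero) = 1#
  fromℕ (suc (suc n)) = 1# + fromℕ (suc n)

  fromℕ-suc : ∀ n → fromℕ (suc n) ≈ 1# + fromℕ n
  fromℕ-suc zero = sym (+-identityʳ 1#)
  fromℕ-suc (suc n) = refl

  fromℕ-+ : ∀ m n → fromℕ (m +ℕ n) ≈ fromℕ m + fromℕ n
  fromℕ-+ zero n = sym (+-identityˡ _)
  fromℕ-+ (suc m) n = begin
    fromℕ (suc (m +ℕ n))    ≈⟨ fromℕ-suc (m +ℕ n) ⟩
    1# + fromℕ (m +ℕ n)     ≈⟨ +-congˡ (fromℕ-+ m n) ⟩
    1# + (fromℕ m + fromℕ n) ≈⟨ sym (+-assoc _ _ _) ⟩
    (1# + fromℕ m) + fromℕ n ≈⟨ +-congʳ (sym (fromℕ-suc m)) ⟩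
    fromℕ (suc m) + fromℕ n ∎

  fromℕ-* : ∀ m n → fromℕ (m *ℕ n) ≈ fromℕ m * fromℕ n
  fromℕ-* zero n = sym (zeroˡ _)
  fromℕ-* (suc m) n = begin
    fromℕ (n +ℕ m *ℕ n)           ≈⟨ fromℕ-+ n (m *ℕ n) ⟩
    fromℕ n + fromℕ (m *ℕ n)      ≈⟨ +-cong (sym (*-identityˡ _)) (fromℕ-* m n) ⟩
    1# * fromℕ n + fromℕ m * fromℕ n ≈⟨ sym (distribʳ _ _ _) ⟩
    (1# + fromℕ m) * fromℕ n      ≈⟨ *-congʳ (sym (fromℕ-suc m)) ⟩
    fromℕ (suc m) * fromℕ n ∎

  fromℤ : ℤ → Carrier
  fromℤ (+ n) = fromℕ n
  fromℤ -[1+ n ] = - fromℕ (suc n)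

  fromℤ-⊖ : ∀ m n → fromℤ (m ⊖ n) ≈ fromℕ m - fromℕ n
  fromℤ-⊖ m zero rewrite ℤP.⊖-≥ {m} {0} z≤n = begin
    fromℕ m       ≈⟨ sym (+-identityʳ _) ⟩
    fromℕ m + 0#  ≈⟨ +-congˡ (sym -0#≈0#) ⟩
    fromℕ m - 0# ∎
  fromℤ-⊖ zero (suc n) rewrite ℤP.⊖-< {0} {suc n} (s≤s z≤n) = sym (+-identityˡ _)
  fromℤ-⊖ (suc m) (suc n) rewrite ℤP.[1+m]⊖[1+n]≡m⊖n m n = begin
    fromℤ (m ⊖ n)                        ≈⟨ fromℤ-⊖ m n ⟩
    fromℕ m - fromℕ n                    ≈⟨ sym (+-identityˡ _) ⟩
    0# + (fromℕ m - fromℕ n)             ≈⟨ +-congʳ (sym (-‿inverseʳ 1#)) ⟩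
    (1# - 1#) + (fromℕ m - fromℕ n)      ≈⟨ interchange _ _ _ _ ⟩
    (1# + fromℕ m) + (- 1# - fromℕ n)    ≈⟨ +-congˡ (⁻¹-∙-comm _ _) ⟩
    (1# + fromℕ m) - (1# + fromℕ n)      ≈⟨ +-cong (sym (fromℕ-suc m)) (-‿cong (sym (fromℕ-suc n))) ⟩
    fromℕ (suc m) - fromℕ (suc n) ∎

  fromℤ-+ : ∀ i j → fromℤ (i ℤ.+ j) ≈ fromℤ i + fromℤ j
  fromℤ-+ (+ m) (+ n) = fromℕ-+ m n
  fromℤ-+ (+ m) -[1+ n ] = fromℤ-⊖ m (suc n)
  fromℤ-+ -[1+ m ] (+ n) = trans (fromℤ-⊖ n (suc m)) (+-comm _ _)
  fromℤ-+ -[1+ m ] -[1+ n ] = begin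
    - fromℕ (suc (suc (m +ℕ n)))         ≈⟨ -‿cong (reflexive (≡.cong (λ k → fromℕ (suc k)) (≡.sym (ℕP.+-suc m n)))) ⟩
    - fromℕ (suc m +ℕ suc n)             ≈⟨ -‿cong (fromℕ-+ (suc m) (suc n)) ⟩
    - (fromℕ (suc m) + fromℕ (suc n))    ≈⟨ sym (⁻¹-∙-comm _ _) ⟩
    - fromℕ (suc m) - fromℕ (suc n) ∎

  signed : Sign.Sign → Carrier → Carrier
  signed Sign.+ x = x
  signed Sign.- x = - x

  signed-cong : ∀ s {x y} → x ≈ y → signed s x ≈ signed s y
  signed-cong Sign.+ e = e
  signed-cong Sign.- e = -‿cong e

  fromℤ-◃ : ∀ s n → fromℤ (s ◃ n) ≈ signed s (fromℕ n)
  fromℤ-◃ Sign.+ zero = refl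
  fromℤ-◃ Sign.- zero = sym -0#≈0#
  fromℤ-◃ Sign.+ (suc n) = refl
  fromℤ-◃ Sign.- (suc n) = refl

  fromℤ-sign-abs : ∀ i → fromℤ i ≈ signed (sign i) (fromℕ ∣ i ∣)
  fromℤ-sign-abs (+ n) = refl
  fromℤ-sign-abs -[1+ n ] = refl

  signed-* : ∀ s t x y → signed (s Sign.* t) (x * y) ≈ signed s x * signed t y
  signed-* Sign.+ Sign.+ x y = refl
  signed-* Sign.+ Sign.- x y = -‿distribʳ-* x y
  signed-* Sign.- Sign.+ x y = -‿distribˡ-* x y
  signed-* Sign.- Sign.- x y = begin
    x * y           ≈⟨ sym (-‿involutive _) ⟩
    - (- (x * y))   ≈⟨ -‿cong (-‿distribˡ-* x y) ⟩
    - (- x * y)     ≈⟨ -‿distribʳ-* _ _ ⟩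
    - x * - y ∎

  fromℤ-* : ∀ i j → fromℤ (i ℤ.* j) ≈ fromℤ i * fromℤ j
  fromℤ-* i j = begin
    fromℤ ((sign i Sign.* sign j) ◃ (∣ i ∣ *ℕ ∣ j ∣))      ≈⟨ fromℤ-◃ (sign i Sign.* sign j) (∣ i ∣ *ℕ ∣ j ∣) ⟩
    signed (sign i Sign.* sign j) (fromℕ (∣ i ∣ *ℕ ∣ j ∣)) ≈⟨ signed-cong (sign i Sign.* sign j) (fromℕ-* ∣ i ∣ ∣ j ∣) ⟩
    signed (sign i Sign.* sign j) (fromℕ ∣ i ∣ * fromℕ ∣ j ∣) ≈⟨ signed-* (sign i) (sign j) _ _ ⟩
    signed (sign i) (fromℕ ∣ i ∣) * signed (sign j) (fromℕ ∣ j ∣) ≈⟨ *-cong (sym (fromℤ-sign-abs i)) (sym (fromℤ-sign-abs j)) ⟩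
    fromℤ i * fromℤ j ∎

  fromℤ-neg : ∀ i → fromℤ (ℤ.- i) ≈ - fromℤ i
  fromℤ-neg (+ zero) = sym -0#≈0#
  fromℤ-neg (+ suc n) = refl
  fromℤ-neg -[1+ n ] = sym (-‿involutive _)

  fromℤ-morphism : ℤ.+-*-rawRing ACR.-Raw-AlmostCommutative⟶ ACR.fromCommutativeRing R
  fromℤ-morphism = record
    { ⟦_⟧ = fromℤ ; +-homo = fromℤ-+ ; *-homo = fromℤ-* ; -‿homo = fromℤ-neg
    ; 0-homo = refl ; 1-homo = refl }

  fromℤ-≟ : WeaklyDecidable (ACR.Induced-equivalence fromℤ-morphism)
  fromℤ-≟ i j with i ℤP.≟ j
  ... | yes ≡.refl = just refl
  ... | no _ = nothing

  open import Algebra.Solver.Ring ℤ.+-*-rawRing (ACR.fromCommutativeRing R) fromℤ-morphism fromℤ-≟ public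
    using (solve; _:+_; _:*_; _:-_; :-_; _:=_; con)

module PowerSeries {c ℓ} (R : CommutativeRing c ℓ) (inv : ℕ → CommutativeRing.Carrier R) where
  open CommutativeRing R
  open Series R inv public
  open IntegerSolver R using (solve; _:+_; _:*_; _:=_)
  open import Algebra.Properties.CommutativeSemigroup +-commutativeSemigroup using (interchange)
  open SetoidReasoning setoid

  InvertsPositiveIntegers : Set ℓ
  InvertsPositiveIntegers = ∀ n → ιℕ (suc n) * inv (suc n) ≈ 1#

  ιℕ-+ : ∀ m n → ιℕ (m +ℕ n) ≈ ιℕ m + ιℕ n
  ιℕ-+ zero n = sym (+-identityˡ _)
  ιℕ-+ (suc m) n = trans (+-congˡ (ιℕ-+ m n)) (sym (+-assoc _ _ _))

  ιℕ-* : ∀ m n → ιℕ (m *ℕ n) ≈ ιℕ m * ιℕ n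
  ιℕ-* zero n = sym (zeroˡ _)
  ιℕ-* (suc m) n = begin
    ιℕ (n +ℕ m *ℕ n)            ≈⟨ ιℕ-+ n (m *ℕ n) ⟩
    ιℕ n + ιℕ (m *ℕ n)          ≈⟨ +-cong (sym (*-identityˡ _)) (ιℕ-* m n) ⟩
    1# * ιℕ n + ιℕ m * ιℕ n     ≈⟨ sym (distribʳ _ _ _) ⟩
    (1# + ιℕ m) * ιℕ n ∎

  pow-congˡ : ∀ {x y} → x ≈ y → ∀ k → pow x k ≈ pow y k
  pow-congˡ e zero = refl
  pow-congˡ e (suc k) = *-cong e (pow-congˡ e k)

  pow-+ : ∀ x m n → pow x (m +ℕ n) ≈ pow x m * pow x n
  pow-+ x zero n = sym (*-identityˡ _)
  pow-+ x (suc m) n = trans (*-congˡ (pow-+ x m n)) (sym (*-assoc _ _ _))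

  pow-*-distrib : ∀ x y k → pow (x * y) k ≈ pow x k * pow y k
  pow-*-distrib x y zero = sym (*-identityˡ _)
  pow-*-distrib x y (suc k) = trans (*-congˡ (pow-*-distrib x y k))
    (solve 4 (λ x y a b → (x :* y) :* (a :* b) := (x :* a) :* (y :* b)) refl _ _ _ _)

  pow-double : ∀ x k → pow x (2 *ℕ k) ≈ pow (x * x) k
  pow-double x k = begin
    pow x (k +ℕ (k +ℕ 0))  ≈⟨ pow-+ x k (k +ℕ 0) ⟩
    pow x k * pow x (k +ℕ 0) ≈⟨ *-congˡ (reflexive (≡.cong (pow x) (ℕP.+-identityʳ k))) ⟩
    pow x k * pow x k      ≈⟨ sym (pow-*-distrib x x k) ⟩
    pow (x * x) k ∎

  sumTo-cong : ∀ n {f g : ℕ → Carrier} → (∀ k → f k ≈ g k) → sumTo n f ≈ sumTo n g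
  sumTo-cong zero e = e 0
  sumTo-cong (suc n) e = +-cong (sumTo-cong n e) (e (suc n))

  sumTo-cong-≤ : ∀ n {f g : ℕ → Carrier} → (∀ k → k ≤ n → f k ≈ g k) → sumTo n f ≈ sumTo n g
  sumTo-cong-≤ zero e = e 0 z≤n
  sumTo-cong-≤ (suc n) e = +-cong (sumTo-cong-≤ n (λ k k≤n → e k (ℕP.m≤n⇒m≤1+n k≤n))) (e (suc n) ℕP.≤-refl)

  sumTo-0# : ∀ n (f : ℕ → Carrier) → (∀ k → k ≤ n → f k ≈ 0#) → sumTo n f ≈ 0#
  sumTo-0# zero f e = e 0 z≤n
  sumTo-0# (suc n) f e = trans (+-cong (sumTo-0# n f (λ k k≤n → e k (ℕP.m≤n⇒m≤1+n k≤n))) (e (suc n) ℕP.≤-refl))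
                                (+-identityʳ 0#)

  sumTo-last : ∀ n (f : ℕ → Carrier) → (∀ k → k < n → f k ≈ 0#) → sumTo n f ≈ f n
  sumTo-last zero f e = refl
  sumTo-last (suc n) f e = trans (+-congʳ (sumTo-0# n f (λ k k≤n → e k (s≤s k≤n)))) (+-identityˡ _)

  sumTo-+ : ∀ n (f g : ℕ → Carrier) → sumTo n (λ k → f k + g k) ≈ sumTo n f + sumTo n g
  sumTo-+ zero f g = refl
  sumTo-+ (suc n) f g = trans (+-congʳ (sumTo-+ n f g)) (interchange _ _ _ _)

  sumTo-*ˡ : ∀ n a (f : ℕ → Carrier) → a * sumTo n f ≈ sumTo n (λ k → a * f k)
  sumTo-*ˡ zero a f = refl
  sumTo-*ˡ (suc n) a f = trans (distribˡ a _ _) (+-congʳ (sumTo-*ˡ n a f))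

  sumTo-*ʳ : ∀ n a (f : ℕ → Carrier) → sumTo n f * a ≈ sumTo n (λ k → f k * a)
  sumTo-*ʳ zero a f = refl
  sumTo-*ʳ (suc n) a f = trans (distribʳ a _ _) (+-congʳ (sumTo-*ʳ n a f))

  sumTo-suc : ∀ n (f : ℕ → Carrier) → sumTo (suc n) f ≈ f 0 + sumTo n (λ k → f (suc k))
  sumTo-suc zero f = refl
  sumTo-suc (suc n) f = trans (+-congʳ (sumTo-suc n f)) (+-assoc _ _ _)

  sumTo-reverse : ∀ n (f : ℕ → Carrier) → sumTo n f ≈ sumTo n (λ k → f (n ∸ k))
  sumTo-reverse zero f = refl
  sumTo-reverse (suc n) f = begin
    sumTo n f + f (suc n)                   ≈⟨ +-congʳ (sumTo-reverse n f) ⟩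
    sumTo n (λ k → f (n ∸ k)) + f (suc n)   ≈⟨ +-comm _ _ ⟩
    f (suc n) + sumTo n (λ k → f (n ∸ k))   ≈⟨ sym (sumTo-suc n (λ k → f (suc n ∸ k))) ⟩
    sumTo (suc n) (λ k → f (suc n ∸ k)) ∎

  sumTo-comm : ∀ n m (f : ℕ → ℕ → Carrier) →
    sumTo n (λ i → sumTo m (f i)) ≈ sumTo m (λ k → sumTo n (λ i → f i k))
  sumTo-comm zero m f = refl
  sumTo-comm (suc n) m f = trans (+-congʳ (sumTo-comm n m f)) (sym (sumTo-+ m _ _))

  sumTo-extend : ∀ i n (f : ℕ → Carrier) → i ≤ n → (∀ k → i < k → f k ≈ 0#) → sumTo i f ≈ sumTo n f
  sumTo-extend i zero f z≤n e = refl
  sumTo-extend i (suc n) f i≤1+n e with ℕP.m≤n⇒m<n∨m≡n i≤1+n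
  ... | inj₂ ≡.refl = refl
  ... | inj₁ (s≤s i≤n) = begin
    sumTo i f             ≈⟨ sumTo-extend i n f i≤n e ⟩
    sumTo n f             ≈⟨ sym (+-identityʳ _) ⟩
    sumTo n f + 0#        ≈⟨ +-congˡ (sym (e (suc n) (s≤s i≤n))) ⟩
    sumTo n f + f (suc n) ∎

  sumList-++ : ∀ xs ys → sumList (xs ++ ys) ≈ sumList xs + sumList ys
  sumList-++ [] ys = sym (+-identityˡ _)
  sumList-++ (x ∷ xs) ys = trans (+-congˡ (sumList-++ xs ys)) (sym (+-assoc _ _ _))

  sumList-cong-All : ∀ {A : Set} {f g : A → Carrier} xs → All (λ x → f x ≈ g x) xs →
    sumList (map f xs) ≈ sumList (map g xs)
  sumList-cong-All [] [] = refl
  sumList-cong-All (x ∷ xs) (e ∷ es) = +-cong e (sumList-cong-All xs es)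

  sumList-cong : ∀ {A : Set} {f g : A → Carrier} xs → (∀ x → f x ≈ g x) →
    sumList (map f xs) ≈ sumList (map g xs)
  sumList-cong [] e = refl
  sumList-cong (x ∷ xs) e = +-cong (e x) (sumList-cong xs e)

  sumList-*ˡ : ∀ {A : Set} a (f : A → Carrier) xs → a * sumList (map f xs) ≈ sumList (map (λ x → a * f x) xs)
  sumList-*ˡ a f [] = zeroʳ _
  sumList-*ˡ a f (x ∷ xs) = trans (distribˡ _ _ _) (+-congˡ (sumList-*ˡ a f xs))

  sumList-+ : ∀ {A : Set} (f g : A → Carrier) xs →
    sumList (map (λ x → f x + g x) xs) ≈ sumList (map f xs) + sumList (map g xs)
  sumList-+ f g [] = sym (+-identityˡ _)
  sumList-+ f g (x ∷ xs) = trans (+-congˡ (sumList-+ f g xs)) (interchange _ _ _ _)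

  sumList-concatMap : ∀ {A B : Set} (f : B → Carrier) (h : A → List B) xs →
    sumList (map f (concatMap h xs)) ≈ sumList (map (λ x → sumList (map f (h x))) xs)
  sumList-concatMap f h [] = refl
  sumList-concatMap f h (x ∷ xs) = begin
    sumList (map f (h x ++ concatMap h xs))                 ≈⟨ reflexive (≡.cong sumList (ListP.map-++ f (h x) _)) ⟩
    sumList (map f (h x) ++ map f (concatMap h xs))         ≈⟨ sumList-++ (map f (h x)) _ ⟩
    sumList (map f (h x)) + sumList (map f (concatMap h xs)) ≈⟨ +-congˡ (sumList-concatMap f h xs) ⟩
    sumList (map f (h x)) + sumList (map (λ x → sumList (map f (h x))) xs) ∎

  infix 4 _≋_
  _≋_ : PS → PS → Set ℓ
  f ≋ g = ∀ n → f n ≈ g n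

  cst : Carrier → PS
  cst a zero = a
  cst a (suc _) = 0#

  _⊕_ : PS → PS → PS
  (f ⊕ g) n = f n + g n

  ⊝_ : PS → PS
  (⊝ f) n = - f n

  mulPS-cong : ∀ {f f′ g g′} → f ≋ f′ → g ≋ g′ → mulPS f g ≋ mulPS f′ g′
  mulPS-cong ef eg n = sumTo-cong n (λ k → *-cong (ef k) (eg (n ∸ k)))

  mulPS-suc : ∀ f g n → mulPS f g (suc n) ≈ f 0 * g (suc n) + mulPS (λ k → f (suc k)) g n
  mulPS-suc f g n = sumTo-suc n (λ k → f k * g (suc n ∸ k))

  mulPS-comm : ∀ f g → mulPS f g ≋ mulPS g f
  mulPS-comm f g n = begin
    sumTo n (λ k → f k * g (n ∸ k))                 ≈⟨ sumTo-reverse n _ ⟩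
    sumTo n (λ k → f (n ∸ k) * g (n ∸ (n ∸ k)))     ≈⟨ sumTo-cong-≤ n (λ k k≤n →
                                                        trans (*-congˡ (reflexive (≡.cong g (ℕP.m∸[m∸n]≡n k≤n)))) (*-comm _ _)) ⟩
    sumTo n (λ k → g k * f (n ∸ k)) ∎

  mulPS-distribˡ : ∀ f g h → mulPS f (g ⊕ h) ≋ (mulPS f g ⊕ mulPS f h)
  mulPS-distribˡ f g h n = trans (sumTo-cong n (λ k → distribˡ _ _ _)) (sumTo-+ n _ _)

  mulPS-distribʳ : ∀ f g h → mulPS (g ⊕ h) f ≋ (mulPS g f ⊕ mulPS h f)
  mulPS-distribʳ f g h n = trans (sumTo-cong n (λ k → distribʳ _ _ _)) (sumTo-+ n _ _)

  mulPS-scalePSˡ : ∀ a f g → mulPS (scalePS a f) g ≋ scalePS a (mulPS f g)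
  mulPS-scalePSˡ a f g n = trans (sumTo-cong n (λ k → *-assoc _ _ _)) (sym (sumTo-*ˡ n a _))

  mulPS-assoc : ∀ f g h → mulPS (mulPS f g) h ≋ mulPS f (mulPS g h)
  mulPS-assoc f g h zero = *-assoc _ _ _
  mulPS-assoc f g h (suc n) = begin
    mulPS (mulPS f g) h (suc n)
      ≈⟨ mulPS-suc (mulPS f g) h n ⟩
    (f 0 * g 0) * h (suc n) + mulPS (λ k → mulPS f g (suc k)) h n
      ≈⟨ +-congˡ (mulPS-cong {g = h} (mulPS-suc f g) (λ _ → refl) n) ⟩
    (f 0 * g 0) * h (suc n) + mulPS (scalePS (f 0) g′ ⊕ mulPS f′ g) h n
      ≈⟨ +-congˡ (mulPS-distribʳ h _ _ n) ⟩
    (f 0 * g 0) * h (suc n) + (mulPS (scalePS (f 0) g′) h n + mulPS (mulPS f′ g) h n)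
      ≈⟨ +-congˡ (+-cong (mulPS-scalePSˡ (f 0) g′ h n) (mulPS-assoc f′ g h n)) ⟩
    (f 0 * g 0) * h (suc n) + (f 0 * mulPS g′ h n + mulPS f′ (mulPS g h) n)
      ≈⟨ solve 5 (λ a b c d e → (a :* b) :* c :+ (a :* d :+ e) := a :* (b :* c :+ d) :+ e) refl _ _ _ _ _ ⟩
    f 0 * (g 0 * h (suc n) + mulPS g′ h n) + mulPS f′ (mulPS g h) n
      ≈⟨ +-congʳ (*-congˡ (sym (mulPS-suc g h n))) ⟩
    f 0 * mulPS g h (suc n) + mulPS f′ (mulPS g h) n
      ≈⟨ sym (mulPS-suc f (mulPS g h) n) ⟩
    mulPS f (mulPS g h) (suc n) ∎
    where
      f′ g′ : PS
      f′ k = f (suc k)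
      g′ k = g (suc k)

  mulPS-cstˡ : ∀ a g → mulPS (cst a) g ≋ scalePS a g
  mulPS-cstˡ a g zero = refl
  mulPS-cstˡ a g (suc n) = begin
    mulPS (cst a) g (suc n)               ≈⟨ mulPS-suc (cst a) g n ⟩
    a * g (suc n) + mulPS (λ _ → 0#) g n  ≈⟨ +-congˡ (sumTo-0# n _ (λ k _ → zeroˡ _)) ⟩
    a * g (suc n) + 0#                    ≈⟨ +-identityʳ _ ⟩
    a * g (suc n) ∎

  seriesRing : CommutativeRing c ℓ
  seriesRing = record
    { Carrier = PS ; _≈_ = _≋_ ; _+_ = _⊕_ ; _*_ = mulPS ; -_ = ⊝_ ; 0# = λ _ → 0# ; 1# = cst 1#
    ; isCommutativeRing = record
      { isRing = record
        { +-isAbelianGroup = record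
          { isGroup = record
            { isMonoid = record
              { isSemigroup = record
                { isMagma = record
                  { isEquivalence = record
                    { refl = λ n → refl ; sym = λ e n → sym (e n) ; trans = λ e e′ n → trans (e n) (e′ n) }
                  ; ∙-cong = λ e e′ n → +-cong (e n) (e′ n) }
                ; assoc = λ f g h n → +-assoc _ _ _ }
              ; identity = (λ f n → +-identityˡ _) , (λ f n → +-identityʳ _) }
            ; inverse = (λ f n → -‿inverseˡ _) , (λ f n → -‿inverseʳ _)
            ; ⁻¹-cong = λ e n → -‿cong (e n) }
          ; comm = λ f g n → +-comm _ _ }
        ; *-cong = mulPS-cong
        ; *-assoc = mulPS-assoc
        ; *-identity = (λ f n → trans (mulPS-cstˡ 1# f n) (*-identityˡ _))
                     , (λ f n → trans (mulPS-comm f (cst 1#) n) (trans (mulPS-cstˡ 1# f n) (*-identityˡ _)))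
        ; distrib = mulPS-distribˡ , mulPS-distribʳ }
      ; *-comm = mulPS-comm } }

  invPS : ℕ → PS
  invPS n = cst (inv n)

  powPS≋pow : ∀ h k → powPS h k ≋ Series.pow seriesRing invPS h k
  powPS≋pow h zero zero = refl
  powPS≋pow h zero (suc n) = refl
  powPS≋pow h (suc k) = mulPS-cong {f = h} (λ _ → refl) (powPS≋pow h k)

  ιℕ-seriesRing : ∀ m → Series.ιℕ seriesRing invPS m ≋ cst (ιℕ m)
  ιℕ-seriesRing zero zero = refl
  ιℕ-seriesRing zero (suc n) = refl
  ιℕ-seriesRing (suc m) zero = +-congˡ (ιℕ-seriesRing m 0)
  ιℕ-seriesRing (suc m) (suc n) = trans (+-congˡ (ιℕ-seriesRing m (suc n))) (+-identityʳ 0#)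

  powPS-0 : ∀ f → powPS f 0 ≋ cst 1#
  powPS-0 f zero = refl
  powPS-0 f (suc n) = refl

  powPS-vanishes-below : ∀ h → h 0 ≈ 0# → ∀ k n → n < k → powPS h k n ≈ 0#
  powPS-vanishes-below h h0 (suc k) zero _ = trans (*-congʳ h0) (zeroˡ _)
  powPS-vanishes-below h h0 (suc k) (suc n) (s≤s n<k) = begin
    mulPS h (powPS h k) (suc n)
      ≈⟨ mulPS-suc h (powPS h k) n ⟩
    h 0 * powPS h k (suc n) + mulPS (λ j → h (suc j)) (powPS h k) n
      ≈⟨ +-cong (trans (*-congʳ h0) (zeroˡ _)) (sumTo-0# n _ (λ j _ → trans (*-congˡ
           (powPS-vanishes-below h h0 k (n ∸ j) (ℕP.≤-<-trans (ℕP.m∸n≤m n j) n<k))) (zeroʳ _))) ⟩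
    0# + 0#
      ≈⟨ +-identityʳ _ ⟩
    0# ∎

-- invS only serves to name ιℕ, pow, sumTo and sumList from Series S invS, none of which depends on it.
module Derivation {c ℓ} (S : CommutativeRing c ℓ) (invS : ℕ → CommutativeRing.Carrier S) where
  open CommutativeRing S
  open PowerSeries S invS using (ιℕ; pow; sumTo; sumList)
  open IntegerSolver S using (solve; _:+_; _:*_; _:-_; _:=_; con)
  open SetoidReasoning setoid

  record IsDerivation (δ : Carrier → Carrier) : Set (c ⊔ ℓ) where
    field
      δ-cong : ∀ {x y} → x ≈ y → δ x ≈ δ y
      δ-+ : ∀ x y → δ (x + y) ≈ δ x + δ y
      δ-* : ∀ x y → δ (x * y) ≈ δ x * y + x * δ y

    δ-0# : δ 0# ≈ 0#
    δ-0# = begin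
      δ 0#                 ≈⟨ solve 1 (λ a → a := (a :+ a) :- a) refl _ ⟩
      (δ 0# + δ 0#) - δ 0# ≈⟨ +-congʳ (sym (δ-+ 0# 0#)) ⟩
      δ (0# + 0#) - δ 0#   ≈⟨ +-congʳ (δ-cong (+-identityʳ 0#)) ⟩
      δ 0# - δ 0#          ≈⟨ -‿inverseʳ _ ⟩
      0# ∎

    δ-1# : δ 1# ≈ 0#
    δ-1# = begin
      δ 1#                               ≈⟨ solve 1 (λ a → a := (a :* con (ℤ.+ 1) :+ con (ℤ.+ 1) :* a) :- a) refl _ ⟩
      (δ 1# * 1# + 1# * δ 1#) - δ 1#     ≈⟨ +-congʳ (sym (δ-* 1# 1#)) ⟩
      δ (1# * 1#) - δ 1#                 ≈⟨ +-congʳ (δ-cong (*-identityˡ 1#)) ⟩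
      δ 1# - δ 1#                        ≈⟨ -‿inverseʳ _ ⟩
      0# ∎

    δ-neg : ∀ x → δ (- x) ≈ - δ x
    δ-neg x = begin
      δ (- x)               ≈⟨ solve 2 (λ a b → a := (a :+ b) :- b) refl _ _ ⟩
      (δ (- x) + δ x) - δ x ≈⟨ +-congʳ (sym (δ-+ _ _)) ⟩
      δ (- x + x) - δ x     ≈⟨ +-congʳ (δ-cong (-‿inverseˡ x)) ⟩
      δ 0# - δ x            ≈⟨ +-congʳ δ-0# ⟩
      0# - δ x              ≈⟨ +-identityˡ _ ⟩
      - δ x ∎

    δ-*-constantˡ : ∀ a x → δ a ≈ 0# → δ (a * x) ≈ a * δ x
    δ-*-constantˡ a x δa≈0 = trans (δ-* _ _) (trans (+-congʳ (trans (*-congʳ δa≈0) (zeroˡ _))) (+-identityˡ _))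

    δ-*-constant : ∀ x y → δ x ≈ 0# → δ y ≈ 0# → δ (x * y) ≈ 0#
    δ-*-constant x y δx≈0 δy≈0 = trans (δ-*-constantˡ x y δx≈0) (trans (*-congˡ δy≈0) (zeroʳ _))

    δ-ιℕ : ∀ m → δ (ιℕ m) ≈ 0#
    δ-ιℕ zero = δ-0#
    δ-ιℕ (suc m) = trans (δ-+ _ _) (trans (+-cong δ-1# (δ-ιℕ m)) (+-identityˡ 0#))

    δ-pow : ∀ x k → δ (pow x (suc k)) ≈ ιℕ (suc k) * pow x k * δ x
    δ-pow x zero = begin
      δ (x * 1#)               ≈⟨ δ-cong (*-identityʳ x) ⟩
      δ x                      ≈⟨ solve 1 (λ a → a := (con (ℤ.+ 1) :+ con (ℤ.+ 0)) :* con (ℤ.+ 1) :* a) refl _ ⟩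
      (1# + 0#) * 1# * δ x ∎
    δ-pow x (suc k) = begin
      δ (x * pow x (suc k))                            ≈⟨ δ-* _ _ ⟩
      δ x * pow x (suc k) + x * δ (pow x (suc k))      ≈⟨ +-congˡ (*-congˡ (δ-pow x k)) ⟩
      δ x * (x * pow x k) + x * (ιℕ (suc k) * pow x k * δ x)
        ≈⟨ solve 4 (λ d x p i → d :* (x :* p) :+ x :* (i :* p :* d) := (con (ℤ.+ 1) :+ i) :* (x :* p) :* d) refl _ _ _ _ ⟩
      (1# + ιℕ (suc k)) * (x * pow x k) * δ x ∎

    δ-pow-constant : ∀ x k → δ x ≈ 0# → δ (pow x k) ≈ 0#
    δ-pow-constant x zero δx≈0 = δ-1#
    δ-pow-constant x (suc k) δx≈0 = δ-*-constant x (pow x k) δx≈0 (δ-pow-constant x k δx≈0)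

    δ-sumTo : ∀ n f → δ (sumTo n f) ≈ sumTo n (λ k → δ (f k))
    δ-sumTo zero f = refl
    δ-sumTo (suc n) f = trans (δ-+ _ _) (+-congʳ (δ-sumTo n f))

    δ-sumList : ∀ {A : Set} (f : A → Carrier) xs → δ (sumList (map f xs)) ≈ sumList (map (λ x → δ (f x)) xs)
    δ-sumList f [] = δ-0#
    δ-sumList f (x ∷ xs) = trans (δ-+ _ _) (+-congˡ (δ-sumList f xs))

  *-isDerivation : ∀ q {δ} → IsDerivation δ → IsDerivation (λ x → q * δ x)
  *-isDerivation q D = record
    { δ-cong = λ e → *-congˡ (δ-cong e)
    ; δ-+ = λ x y → trans (*-congˡ (δ-+ x y)) (distribˡ _ _ _)
    ; δ-* = λ x y → trans (*-congˡ (δ-* x y))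
        (solve 5 (λ q a y x b → q :* (a :* y :+ x :* b) := (q :* a) :* y :+ x :* (q :* b)) refl _ _ _ _ _) }
    where open IsDerivation D

  -- G ∂F + γ (∂G) F = G^(1-γ) ∂(G^γ F), which vanishes exactly when F is a constant multiple of G^(-γ).
  module Defect {∂ δ} (∂-isDerivation : IsDerivation ∂) (δ-isDerivation : IsDerivation δ)
                (∂δ≈δ∂ : ∀ f → ∂ (δ f) ≈ δ (∂ f)) (X γ F G : Carrier)
                (∂X≈0 : ∂ X ≈ 0#) (∂γ≈0 : ∂ γ ≈ 0#) (δγ≈0 : δ γ ≈ 0#)
                (∂F≈ : ∂ F ≈ X * γ * F + δ F) (∂G≈ : ∂ G ≈ δ G - X * G) where
    open IsDerivation ∂-isDerivation renaming (δ-cong to ∂-cong; δ-+ to ∂-+; δ-* to ∂-*; δ-neg to ∂-neg)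
    open IsDerivation δ-isDerivation using (δ-+; δ-*)

    defect : Carrier
    defect = G * ∂ F + γ * (∂ G * F)

    ∂∂F≈ : ∂ (∂ F) ≈ X * γ * ∂ F + δ (∂ F)
    ∂∂F≈ = begin
      ∂ (∂ F)                                ≈⟨ ∂-cong ∂F≈ ⟩
      ∂ (X * γ * F + δ F)                    ≈⟨ ∂-+ _ _ ⟩
      ∂ (X * γ * F) + ∂ (δ F)                ≈⟨ +-cong (∂-* _ _) (∂δ≈δ∂ F) ⟩
      ∂ (X * γ) * F + X * γ * ∂ F + δ (∂ F)  ≈⟨ +-congʳ (+-congʳ (trans (*-congʳ ∂Xγ≈0) (zeroˡ F))) ⟩
      0# + X * γ * ∂ F + δ (∂ F)             ≈⟨ +-congʳ (+-identityˡ _) ⟩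
      X * γ * ∂ F + δ (∂ F) ∎
      where
        ∂Xγ≈0 : ∂ (X * γ) ≈ 0#
        ∂Xγ≈0 = trans (∂-* X γ)
          (trans (+-cong (trans (*-congʳ ∂X≈0) (zeroˡ γ)) (trans (*-congˡ ∂γ≈0) (zeroʳ X))) (+-identityʳ 0#))

    ∂∂G≈ : ∂ (∂ G) ≈ δ (∂ G) - X * ∂ G
    ∂∂G≈ = begin
      ∂ (∂ G)                         ≈⟨ ∂-cong ∂G≈ ⟩
      ∂ (δ G - X * G)                 ≈⟨ ∂-+ _ _ ⟩
      ∂ (δ G) + ∂ (- (X * G))         ≈⟨ +-cong (∂δ≈δ∂ G) (∂-neg _) ⟩
      δ (∂ G) - ∂ (X * G)             ≈⟨ +-congˡ (-‿cong (∂-* X G)) ⟩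
      δ (∂ G) - (∂ X * G + X * ∂ G)   ≈⟨ +-congˡ (-‿cong (+-congʳ (trans (*-congʳ ∂X≈0) (zeroˡ G)))) ⟩
      δ (∂ G) - (0# + X * ∂ G)        ≈⟨ +-congˡ (-‿cong (+-identityˡ _)) ⟩
      δ (∂ G) - X * ∂ G ∎

    ∂-defect : ∂ defect ≈ δ defect + ((γ - 1#) * X) * defect
    ∂-defect = begin
      ∂ (G * ∂ F + γ * (∂ G * F))
        ≈⟨ trans (∂-+ _ _) (+-cong (∂-* G (∂ F)) (trans (∂-* γ _) (+-congˡ (*-congˡ (∂-* (∂ G) F))))) ⟩
      (∂ G * ∂ F + G * ∂ (∂ F)) + (∂ γ * (∂ G * F) + γ * (∂ (∂ G) * F + ∂ G * ∂ F))
        ≈⟨ +-cong (+-cong (*-congʳ ∂G≈) (*-congˡ ∂∂F≈))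
                  (+-cong (*-congʳ ∂γ≈0) (*-congˡ (+-cong (*-congʳ ∂∂G≈) (*-congˡ ∂F≈)))) ⟩
      ((δ G - X * G) * ∂ F + G * (X * γ * ∂ F + δ (∂ F)))
        + (0# * (∂ G * F) + γ * ((δ (∂ G) - X * ∂ G) * F + ∂ G * (X * γ * F + δ F)))
        ≈⟨ solve 10 (λ g f df dg δg δf δdf δdg x c →
             ((δg :- x :* g) :* df :+ g :* (x :* c :* df :+ δdf))
               :+ (con (ℤ.+ 0) :* (dg :* f) :+ c :* ((δdg :- x :* dg) :* f :+ dg :* (x :* c :* f :+ δf)))
             := ((δg :* df :+ g :* δdf) :+ (con (ℤ.+ 0) :* (dg :* f) :+ c :* (δdg :* f :+ dg :* δf)))
                  :+ ((c :- con (ℤ.+ 1)) :* x) :* (g :* df :+ c :* (dg :* f)))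
             refl G F (∂ F) (∂ G) (δ G) (δ F) (δ (∂ F)) (δ (∂ G)) X γ ⟩
      ((δ G * ∂ F + G * δ (∂ F)) + (0# * (∂ G * F) + γ * (δ (∂ G) * F + ∂ G * δ F))) + ((γ - 1#) * X) * defect
        ≈⟨ +-congʳ (sym (trans (δ-+ _ _) (+-cong (δ-* G (∂ F))
                             (trans (δ-* γ _) (+-cong (*-congʳ δγ≈0) (*-congˡ (δ-* (∂ G) F))))))) ⟩
      δ defect + ((γ - 1#) * X) * defect ∎

module FormalDerivative {c ℓ} (R : CommutativeRing c ℓ) (inv : ℕ → CommutativeRing.Carrier R) where
  open CommutativeRing R
  open PowerSeries R inv
  open Derivation R inv
  open IntegerSolver R using (solve; _:+_; _:*_; _:=_)
  open SetoidReasoning setoid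
  module SeriesDerivation = Derivation seriesRing invPS

  ∂ : PS → PS
  ∂ f n = ιℕ (suc n) * f (suc n)

  ∂-cong : ∀ {f g} → f ≋ g → ∂ f ≋ ∂ g
  ∂-cong e n = *-congˡ (e (suc n))

  ∂-⊕ : ∀ f g → ∂ (f ⊕ g) ≋ (∂ f ⊕ ∂ g)
  ∂-⊕ f g n = distribˡ _ _ _

  ∂-⊝ : ∀ f → ∂ (⊝ f) ≋ (⊝ ∂ f)
  ∂-⊝ f n = sym (-‿distribʳ-* _ _)
    where open import Algebra.Properties.Ring ring using (-‿distribʳ-*)

  ∂-cst : ∀ a → ∂ (cst a) ≋ (λ _ → 0#)
  ∂-cst a n = zeroʳ _

  ∂-scalePS : ∀ a f → ∂ (scalePS a f) ≋ mulPS (cst a) (∂ f)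
  ∂-scalePS a f n = trans (solve 3 (λ i a x → i :* (a :* x) := a :* (i :* x)) refl _ _ _) (sym (mulPS-cstˡ a (∂ f) n))

  ∂-mulPS : ∀ f g → ∂ (mulPS f g) ≋ (mulPS (∂ f) g ⊕ mulPS f (∂ g))
  ∂-mulPS f g n = begin
    ιℕ (suc n) * sumTo (suc n) (λ k → f k * g (suc n ∸ k))   ≈⟨ sumTo-*ˡ (suc n) _ _ ⟩
    sumTo (suc n) (λ k → ιℕ (suc n) * (f k * g (suc n ∸ k))) ≈⟨ sumTo-cong-≤ (suc n) split ⟩
    sumTo (suc n) (λ k → A k + B k)                          ≈⟨ sumTo-+ (suc n) A B ⟩
    sumTo (suc n) A + sumTo (suc n) B                        ≈⟨ +-cong sumA sumB ⟩
    mulPS (∂ f) g n + mulPS f (∂ g) n ∎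
    where
      A B : ℕ → Carrier
      A k = ιℕ k * (f k * g (suc n ∸ k))
      B k = f k * (ιℕ (suc n ∸ k) * g (suc n ∸ k))
      split : ∀ k → k ≤ suc n → ιℕ (suc n) * (f k * g (suc n ∸ k)) ≈ A k + B k
      split k k≤1+n = begin
        ιℕ (suc n) * (f k * g (suc n ∸ k))
          ≈⟨ *-congʳ (reflexive (≡.cong ιℕ (≡.sym (ℕP.m+[n∸m]≡n k≤1+n)))) ⟩
        ιℕ (k +ℕ (suc n ∸ k)) * (f k * g (suc n ∸ k))
          ≈⟨ *-congʳ (ιℕ-+ k _) ⟩
        (ιℕ k + ιℕ (suc n ∸ k)) * (f k * g (suc n ∸ k))
          ≈⟨ solve 4 (λ a b x y → (a :+ b) :* (x :* y) := a :* (x :* y) :+ x :* (b :* y)) refl _ _ _ _ ⟩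
        A k + B k ∎
      sumA : sumTo (suc n) A ≈ mulPS (∂ f) g n
      sumA = begin
        sumTo (suc n) A                                  ≈⟨ sumTo-suc n A ⟩
        0# * (f 0 * g (suc n)) + sumTo n (λ k → A (suc k)) ≈⟨ +-congʳ (zeroˡ _) ⟩
        0# + sumTo n (λ k → A (suc k))                   ≈⟨ +-identityˡ _ ⟩
        sumTo n (λ k → A (suc k))                        ≈⟨ sumTo-cong n (λ k → sym (*-assoc _ _ _)) ⟩
        mulPS (∂ f) g n ∎
      sumB : sumTo (suc n) B ≈ mulPS f (∂ g) n
      sumB = begin
        sumTo n B + B (suc n)
          ≈⟨ +-congˡ (trans (*-congˡ (trans (*-congʳ (reflexive (≡.cong ιℕ (ℕP.n∸n≡0 n)))) (zeroˡ _))) (zeroʳ _)) ⟩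
        sumTo n B + 0#
          ≈⟨ +-identityʳ _ ⟩
        sumTo n B
          ≈⟨ sumTo-cong-≤ n (λ k k≤n → *-congˡ (reflexive (≡.cong (λ m → ιℕ m * g m) (ℕP.+-∸-assoc 1 k≤n)))) ⟩
        mulPS f (∂ g) n ∎

  ∂-isDerivation : SeriesDerivation.IsDerivation ∂
  ∂-isDerivation = record { δ-cong = ∂-cong ; δ-+ = ∂-⊕ ; δ-* = ∂-mulPS }

  coefficientwise : ∀ {δ} → IsDerivation δ → SeriesDerivation.IsDerivation (λ f n → δ (f n))
  coefficientwise {δ} D = record
    { δ-cong = λ e n → δ-cong (e n)
    ; δ-+ = λ f g n → δ-+ (f n) (g n)
    ; δ-* = λ f g n → begin
        δ (sumTo n (λ k → f k * g (n ∸ k)))                          ≈⟨ δ-sumTo n _ ⟩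
        sumTo n (λ k → δ (f k * g (n ∸ k)))                          ≈⟨ sumTo-cong n (λ k → δ-* _ _) ⟩
        sumTo n (λ k → δ (f k) * g (n ∸ k) + f k * δ (g (n ∸ k)))    ≈⟨ sumTo-+ n _ _ ⟩
        mulPS (λ m → δ (f m)) g n + mulPS f (λ m → δ (g m)) n ∎ }
    where open IsDerivation D

  ∂-coefficientwise-comm : ∀ {δ} → IsDerivation δ → ∀ f → ∂ (λ n → δ (f n)) ≋ (λ n → δ (∂ f n))
  ∂-coefficientwise-comm D f n = sym (δ-*-constantˡ (ιℕ (suc n)) (f (suc n)) (δ-ιℕ (suc n)))
    where open IsDerivation D

  ∂-powPS : ∀ h k → ∂ (powPS h (suc k)) ≋ scalePS (ιℕ (suc k)) (mulPS (powPS h k) (∂ h))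
  ∂-powPS h k n = begin
    ∂ (powPS h (suc k)) n
      ≈⟨ ∂-cong (powPS≋pow h (suc k)) n ⟩
    ∂ (pow′ h (suc k)) n
      ≈⟨ SeriesDerivation.IsDerivation.δ-pow ∂-isDerivation h k n ⟩
    mulPS (mulPS (ιℕ′ (suc k)) (pow′ h k)) (∂ h) n
      ≈⟨ mulPS-assoc (ιℕ′ (suc k)) (pow′ h k) (∂ h) n ⟩
    mulPS (ιℕ′ (suc k)) (mulPS (pow′ h k) (∂ h)) n
      ≈⟨ mulPS-cong (ιℕ-seriesRing (suc k)) (mulPS-cong {g = ∂ h} (λ m → sym (powPS≋pow h k m)) (λ _ → refl)) n ⟩
    mulPS (cst (ιℕ (suc k))) (mulPS (powPS h k) (∂ h)) n
      ≈⟨ mulPS-cstˡ (ιℕ (suc k)) (mulPS (powPS h k) (∂ h)) n ⟩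
    ιℕ (suc k) * mulPS (powPS h k) (∂ h) n ∎
    where open Series seriesRing invPS using () renaming (pow to pow′; ιℕ to ιℕ′)

module ExpLog {c ℓ} (R : CommutativeRing c ℓ) (inv : ℕ → CommutativeRing.Carrier R)
              (inv-correct : PowerSeries.InvertsPositiveIntegers R inv) where
  open CommutativeRing R
  open PowerSeries R inv
  open FormalDerivative R inv
  open IntegerSolver R using (solve; _:+_; _:*_; _:-_; :-_; _:=_; con)
  open SetoidReasoning setoid
  module 𝕎 where
    open CommutativeRing seriesRing public
    open IntegerSolver seriesRing public using (solve; _:+_; _:*_; _:-_; _:=_)
    open SetoidReasoning (CommutativeRing.setoid seriesRing) public

  inv-!-correct : ∀ k → ιℕ (k !) * inv (k !) ≈ 1#
  inv-!-correct k = ≡.subst (λ m → ιℕ m * inv m ≈ 1#) (ℕP.suc-pred (k !) {{k ℕP.!≢0}}) (inv-correct _)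

  cancel-inv-! : ∀ n {x y} → x * inv (n !) ≈ inv (n !) * y → x ≈ y
  cancel-inv-! n {x} {y} eq = begin
    x                              ≈⟨ sym (*-identityʳ x) ⟩
    x * 1#                         ≈⟨ *-congˡ (sym (inv-!-correct n)) ⟩
    x * (ιℕ (n !) * inv (n !))     ≈⟨ solve 3 (λ x a i → x :* (a :* i) := a :* (x :* i)) refl _ _ _ ⟩
    ιℕ (n !) * (x * inv (n !))     ≈⟨ *-congˡ eq ⟩
    ιℕ (n !) * (inv (n !) * y)     ≈⟨ sym (*-assoc _ _ _) ⟩
    ιℕ (n !) * inv (n !) * y       ≈⟨ *-congʳ (inv-!-correct n) ⟩
    1# * y                         ≈⟨ *-identityˡ y ⟩
    y ∎

  inv-1 : inv 1 ≈ 1#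
  inv-1 = trans (sym (*-identityˡ _)) (trans (*-congʳ (sym (+-identityʳ 1#))) (inv-correct 0))

  ιℕ-*-inv-suc! : ∀ k → ιℕ (suc k) * inv (suc k !) ≈ inv (k !)
  ιℕ-*-inv-suc! k = begin
    ιℕ (suc k) * inv (suc k !)                                ≈⟨ sym (*-identityʳ _) ⟩
    ιℕ (suc k) * inv (suc k !) * 1#                           ≈⟨ *-congˡ (sym (inv-!-correct k)) ⟩
    ιℕ (suc k) * inv (suc k !) * (ιℕ (k !) * inv (k !))
      ≈⟨ solve 4 (λ a b x y → a :* b :* (x :* y) := (a :* x) :* b :* y) refl _ _ _ _ ⟩
    (ιℕ (suc k) * ιℕ (k !)) * inv (suc k !) * inv (k !)       ≈⟨ *-congʳ (*-congʳ (sym (ιℕ-* (suc k) (k !)))) ⟩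
    ιℕ (suc k !) * inv (suc k !) * inv (k !)                  ≈⟨ *-congʳ (inv-!-correct (suc k)) ⟩
    1# * inv (k !)                                            ≈⟨ *-identityˡ _ ⟩
    inv (k !) ∎

  cancel-ιℕ-suc : ∀ n x → x ≈ inv (suc n) * (ιℕ (suc n) * x)
  cancel-ιℕ-suc n x = begin
    x                               ≈⟨ sym (*-identityˡ _) ⟩
    1# * x                          ≈⟨ *-congʳ (sym (inv-correct n)) ⟩
    ιℕ (suc n) * inv (suc n) * x    ≈⟨ solve 3 (λ a b x → a :* b :* x := b :* (a :* x)) refl _ _ _ ⟩
    inv (suc n) * (ιℕ (suc n) * x) ∎

  invPS-correct : PowerSeries.InvertsPositiveIntegers seriesRing invPS
  invPS-correct n m = begin
    mulPS (Series.ιℕ seriesRing invPS (suc n)) (invPS (suc n)) m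
      ≈⟨ mulPS-cong {g = invPS (suc n)} (ιℕ-seriesRing (suc n)) (λ _ → refl) m ⟩
    mulPS (cst (ιℕ (suc n))) (invPS (suc n)) m
      ≈⟨ mulPS-cstˡ (ιℕ (suc n)) (invPS (suc n)) m ⟩
    ιℕ (suc n) * invPS (suc n) m
      ≈⟨ unit m ⟩
    cst 1# m ∎
    where
      unit : ∀ m → ιℕ (suc n) * invPS (suc n) m ≈ cst 1# m
      unit zero = inv-correct n
      unit (suc m) = zeroʳ _

  ιℕ-suc-*-scalePS-inv-suc! : ∀ n f →
    mulPS (Series.ιℕ seriesRing invPS (suc n)) (scalePS (inv (suc n !)) f) ≋ scalePS (inv (n !)) f
  ιℕ-suc-*-scalePS-inv-suc! n f m = begin
    mulPS (Series.ιℕ seriesRing invPS (suc n)) (scalePS (inv (suc n !)) f) m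
      ≈⟨ mulPS-cong {g = scalePS (inv (suc n !)) f} (ιℕ-seriesRing (suc n)) (λ _ → refl) m ⟩
    mulPS (cst (ιℕ (suc n))) (scalePS (inv (suc n !)) f) m
      ≈⟨ mulPS-cstˡ (ιℕ (suc n)) (scalePS (inv (suc n !)) f) m ⟩
    ιℕ (suc n) * (inv (suc n !) * f m)
      ≈⟨ sym (*-assoc _ _ _) ⟩
    ιℕ (suc n) * inv (suc n !) * f m
      ≈⟨ *-congʳ (ιℕ-*-inv-suc! n) ⟩
    inv (n !) * f m ∎

  module Composition (h : PS) (h0≈0 : h 0 ≈ 0#) (a : ℕ → Carrier) where
    compose : PS
    compose n = sumTo n (λ k → a k * powPS h k n)

    compose-extend : ∀ n N → n ≤ N → sumTo N (λ k → a k * powPS h k n) ≈ compose n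
    compose-extend n N n≤N = sym (sumTo-extend n N _ n≤N (λ k n<k →
      trans (*-congˡ (powPS-vanishes-below h h0≈0 k n n<k)) (zeroʳ _)))

    compose-mulPS : ∀ φ n → sumTo n (λ k → a k * mulPS (powPS h k) φ n) ≈ mulPS compose φ n
    compose-mulPS φ n = begin
      sumTo n (λ k → a k * mulPS (powPS h k) φ n)
        ≈⟨ sumTo-cong n (λ k → sumTo-*ˡ n (a k) _) ⟩
      sumTo n (λ k → sumTo n (λ i → a k * (powPS h k i * φ (n ∸ i))))
        ≈⟨ sumTo-comm n n _ ⟩
      sumTo n (λ i → sumTo n (λ k → a k * (powPS h k i * φ (n ∸ i))))
        ≈⟨ sumTo-cong n (λ i → trans (sumTo-cong n (λ k → sym (*-assoc _ _ _))) (sym (sumTo-*ʳ n _ _))) ⟩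
      sumTo n (λ i → sumTo n (λ k → a k * powPS h k i) * φ (n ∸ i))
        ≈⟨ sumTo-cong-≤ n (λ i i≤n → *-congʳ (compose-extend i n i≤n)) ⟩
      mulPS compose φ n ∎

  ∂-expPS : ∀ H → ∂ (expPS H) ≋ mulPS (∂ H) (expPS H)
  ∂-expPS H n = begin
    ιℕ (suc n) * sumTo (suc n) (λ k → inv (k !) * powPS h k (suc n))
      ≈⟨ sumTo-*ˡ (suc n) _ _ ⟩
    sumTo (suc n) (λ k → ιℕ (suc n) * (inv (k !) * powPS h k (suc n)))
      ≈⟨ sumTo-cong (suc n) (λ k → solve 3 (λ a b x → a :* (b :* x) := b :* (a :* x)) refl _ _ _) ⟩
    sumTo (suc n) (λ k → inv (k !) * ∂ (powPS h k) n)
      ≈⟨ sumTo-suc n _ ⟩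
    inv 1 * (ιℕ (suc n) * 0#) + sumTo n (λ k → inv (suc k !) * ∂ (powPS h (suc k)) n)
      ≈⟨ +-cong (trans (*-congˡ (zeroʳ _)) (zeroʳ _)) (sumTo-cong n (λ k → *-congˡ (∂-powPS h k n))) ⟩
    0# + sumTo n (λ k → inv (suc k !) * (ιℕ (suc k) * mulPS (powPS h k) (∂ h) n))
      ≈⟨ +-identityˡ _ ⟩
    sumTo n (λ k → inv (suc k !) * (ιℕ (suc k) * mulPS (powPS h k) (∂ h) n))
      ≈⟨ sumTo-cong n (λ k → trans (solve 3 (λ a b x → a :* (b :* x) := (b :* a) :* x) refl _ _ _)
                                    (*-congʳ (ιℕ-*-inv-suc! k))) ⟩
    sumTo n (λ k → inv (k !) * mulPS (powPS h k) (∂ h) n)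
      ≈⟨ compose-mulPS (∂ h) n ⟩
    mulPS (expPS H) (∂ H) n
      ≈⟨ mulPS-comm (expPS H) (∂ H) n ⟩
    mulPS (∂ H) (expPS H) n ∎
    where
      h = dropConst H
      open Composition h refl (λ k → inv (k !))

  logTerm : PS → ℕ → ℕ → Carrier
  logTerm G n zero = 0#
  logTerm G n (suc k) = pow (- 1#) k * inv (suc k) * powPS (dropConst G) (suc k) n

  logPS≈ : ∀ G n → logPS G n ≈ sumTo n (logTerm G n)
  logPS≈ G n = sumTo-cong n (λ { zero → refl ; (suc k) → refl })

  alternating-telescope : ∀ n (x : ℕ → Carrier) →
    sumTo n (λ k → pow (- 1#) k * x k) + sumTo n (λ k → pow (- 1#) k * x (suc k)) ≈ x 0 + pow (- 1#) n * x (suc n)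
  alternating-telescope zero x = +-congʳ (*-identityˡ _)
  alternating-telescope (suc n) x = begin
    (A + ε (suc n) * x (suc n)) + (B + ε (suc n) * x (suc (suc n)))
      ≈⟨ interchange _ _ _ _ ⟩
    (A + B) + (ε (suc n) * x (suc n) + ε (suc n) * x (suc (suc n)))
      ≈⟨ +-congʳ (alternating-telescope n x) ⟩
    (x 0 + ε n * x (suc n)) + (- 1# * ε n * x (suc n) + - 1# * ε n * x (suc (suc n)))
      ≈⟨ solve 4 (λ a p y z → (a :+ p :* y) :+ ((:- con (ℤ.+ 1)) :* p :* y :+ (:- con (ℤ.+ 1)) :* p :* z)
                             := a :+ (:- con (ℤ.+ 1)) :* p :* z) refl _ _ _ _ ⟩
    x 0 + ε (suc n) * x (suc (suc n)) ∎
    where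
      open import Algebra.Properties.CommutativeSemigroup +-commutativeSemigroup using (interchange)
      ε : ℕ → Carrier
      ε = pow (- 1#)
      A = sumTo n (λ k → ε k * x k)
      B = sumTo n (λ k → ε k * x (suc k))

  module Logarithm (G : PS) (G0≈1 : G 0 ≈ 1#) where
    g : PS
    g = dropConst G
    open Composition g refl (λ k → pow (- 1#) k) renaming (compose to geometric)

    ∂-logPS≋geometric*∂g : ∂ (logPS G) ≋ mulPS geometric (∂ g)
    ∂-logPS≋geometric*∂g n = begin
      ιℕ (suc n) * logPS G (suc n)
        ≈⟨ *-congˡ (logPS≈ G (suc n)) ⟩
      ιℕ (suc n) * sumTo (suc n) (logTerm G (suc n))
        ≈⟨ *-congˡ (trans (sumTo-suc n _) (+-identityˡ _)) ⟩
      ιℕ (suc n) * sumTo n (λ k → logTerm G (suc n) (suc k))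
        ≈⟨ sumTo-*ˡ n _ _ ⟩
      sumTo n (λ k → ιℕ (suc n) * (pow (- 1#) k * inv (suc k) * powPS g (suc k) (suc n)))
        ≈⟨ sumTo-cong n (λ k → solve 4 (λ a p i x → a :* (p :* i :* x) := (p :* i) :* (a :* x)) refl _ _ _ _) ⟩
      sumTo n (λ k → (pow (- 1#) k * inv (suc k)) * ∂ (powPS g (suc k)) n)
        ≈⟨ sumTo-cong n (λ k → *-congˡ (∂-powPS g k n)) ⟩
      sumTo n (λ k → (pow (- 1#) k * inv (suc k)) * (ιℕ (suc k) * mulPS (powPS g k) (∂ g) n))
        ≈⟨ sumTo-cong n (λ k → trans (solve 4 (λ p i a x → (p :* i) :* (a :* x) := p :* ((a :* i) :* x)) refl _ _ _ _)
                                      (*-congˡ (trans (*-congʳ (inv-correct k)) (*-identityˡ _)))) ⟩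
      sumTo n (λ k → pow (- 1#) k * mulPS (powPS g k) (∂ g) n)
        ≈⟨ compose-mulPS (∂ g) n ⟩
      mulPS geometric (∂ g) n ∎

    G≋1+g : G ≋ (cst 1# ⊕ g)
    G≋1+g zero = trans G0≈1 (sym (+-identityʳ _))
    G≋1+g (suc n) = sym (+-identityˡ _)

    mulPS-geometric : mulPS G geometric ≋ cst 1#
    mulPS-geometric n = begin
      mulPS G geometric n
        ≈⟨ mulPS-cong {g = geometric} G≋1+g (λ _ → refl) n ⟩
      mulPS (cst 1# ⊕ g) geometric n
        ≈⟨ mulPS-distribʳ geometric (cst 1#) g n ⟩
      mulPS (cst 1#) geometric n + mulPS g geometric n
        ≈⟨ +-cong (trans (mulPS-cstˡ 1# geometric n) (*-identityˡ _)) (mulPS-comm g geometric n) ⟩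
      geometric n + mulPS geometric g n
        ≈⟨ +-congˡ (sym (compose-mulPS g n)) ⟩
      geometric n + sumTo n (λ k → pow (- 1#) k * mulPS (powPS g k) g n)
        ≈⟨ +-congˡ (sumTo-cong n (λ k → *-congˡ (mulPS-comm (powPS g k) g n))) ⟩
      geometric n + sumTo n (λ k → pow (- 1#) k * powPS g (suc k) n)
        ≈⟨ alternating-telescope n (λ k → powPS g k n) ⟩
      powPS g 0 n + pow (- 1#) n * powPS g (suc n) n
        ≈⟨ +-cong (powPS-0 g n) (trans (*-congˡ (powPS-vanishes-below g refl (suc n) n ℕP.≤-refl)) (zeroʳ _)) ⟩
      cst 1# n + 0#
        ≈⟨ +-identityʳ _ ⟩
      cst 1# n ∎

    ∂-logPS : mulPS G (∂ (logPS G)) ≋ ∂ G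
    ∂-logPS = 𝕎.begin
      mulPS G (∂ (logPS G))             𝕎.≈⟨ 𝕎.*-congˡ {G} ∂-logPS≋geometric*∂g ⟩
      mulPS G (mulPS geometric (∂ g))   𝕎.≈⟨ 𝕎.sym (𝕎.*-assoc G geometric (∂ g)) ⟩
      mulPS (mulPS G geometric) (∂ g)   𝕎.≈⟨ 𝕎.*-congʳ {∂ g} mulPS-geometric ⟩
      mulPS (cst 1#) (∂ g)              𝕎.≈⟨ 𝕎.*-identityˡ (∂ g) ⟩
      ∂ g 𝕎.∎

  cpowPS-ode : ∀ G a → G 0 ≈ 1# → mulPS G (∂ (cpowPS G a)) ≋ mulPS (cst a) (mulPS (∂ G) (cpowPS G a))
  cpowPS-ode G a G0≈1 = 𝕎.begin
    mulPS G (∂ F)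
      𝕎.≈⟨ 𝕎.*-congˡ {G} (∂-expPS L) ⟩
    mulPS G (mulPS (∂ L) F)
      𝕎.≈⟨ 𝕎.*-congˡ {G} (𝕎.*-congʳ {F} (∂-scalePS a (logPS G))) ⟩
    mulPS G (mulPS (mulPS (cst a) (∂ (logPS G))) F)
      𝕎.≈⟨ 𝕎.solve 4 (λ g c d f → g 𝕎.:* ((c 𝕎.:* d) 𝕎.:* f) 𝕎.:= c 𝕎.:* ((g 𝕎.:* d) 𝕎.:* f)) 𝕎.refl G (cst a) (∂ (logPS G)) F ⟩
    mulPS (cst a) (mulPS (mulPS G (∂ (logPS G))) F)
      𝕎.≈⟨ 𝕎.*-congˡ {cst a} (𝕎.*-congʳ {F} (Logarithm.∂-logPS G G0≈1)) ⟩
    mulPS (cst a) (mulPS (∂ G) F) 𝕎.∎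
    where
      L = scalePS a (logPS G)
      F = cpowPS G a

  vanishing-from-∂ : ∀ E → E 0 ≈ 0# → (∀ n → (∀ m → m ≤ n → E m ≈ 0#) → ∂ E n ≈ 0#) → E ≋ (λ _ → 0#)
  vanishing-from-∂ E E0≈0 ∂E≈0 n = vanishes-upto n n ℕP.≤-refl
    where
      vanishes-upto : ∀ n m → m ≤ n → E m ≈ 0#
      vanishes-upto zero _ z≤n = E0≈0
      vanishes-upto (suc n) m m≤1+n with ℕP.m≤n⇒m<n∨m≡n m≤1+n
      ... | inj₁ (s≤s m≤n) = vanishes-upto n m m≤n
      ... | inj₂ ≡.refl = begin
        E (suc n)            ≈⟨ cancel-ιℕ-suc n _ ⟩
        inv (suc n) * ∂ E n  ≈⟨ *-congˡ (∂E≈0 n (vanishes-upto n)) ⟩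
        inv (suc n) * 0#     ≈⟨ zeroʳ _ ⟩
        0# ∎

  ode-unique : ∀ G a F F′ → G 0 ≈ 1#
    → mulPS G (∂ F) ≋ mulPS (cst a) (mulPS (∂ G) F)
    → mulPS G (∂ F′) ≋ mulPS (cst a) (mulPS (∂ G) F′)
    → F 0 ≈ F′ 0 → F ≋ F′
  ode-unique G a F F′ G0≈1 odeF odeF′ F0≈F′0 n = begin
    F n                 ≈⟨ solve 2 (λ x y → x := (x :- y) :+ y) refl _ _ ⟩
    (F n - F′ n) + F′ n ≈⟨ +-congʳ (vanishing-from-∂ Δ (trans (+-congʳ F0≈F′0) (-‿inverseʳ _)) ∂Δ≈0 n) ⟩
    0# + F′ n           ≈⟨ +-identityˡ _ ⟩
    F′ n ∎
    where
      Δ = F 𝕎.- F′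
      odeΔ : mulPS G (∂ Δ) ≋ mulPS (cst a) (mulPS (∂ G) Δ)
      odeΔ = 𝕎.begin
        mulPS G (∂ Δ)
          𝕎.≈⟨ 𝕎.*-congˡ {G} (𝕎.trans (∂-⊕ F (⊝ F′)) (𝕎.+-congˡ {∂ F} (∂-⊝ F′))) ⟩
        mulPS G (∂ F 𝕎.- ∂ F′)
          𝕎.≈⟨ 𝕎.solve 3 (λ g x y → g 𝕎.:* (x 𝕎.:- y) 𝕎.:= g 𝕎.:* x 𝕎.:- g 𝕎.:* y) 𝕎.refl G (∂ F) (∂ F′) ⟩
        mulPS G (∂ F) 𝕎.- mulPS G (∂ F′)
          𝕎.≈⟨ 𝕎.+-cong odeF (𝕎.-‿cong odeF′) ⟩
        mulPS (cst a) (mulPS (∂ G) F) 𝕎.- mulPS (cst a) (mulPS (∂ G) F′)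
          𝕎.≈⟨ 𝕎.solve 4 (λ c d x y → c 𝕎.:* (d 𝕎.:* x) 𝕎.:- c 𝕎.:* (d 𝕎.:* y) 𝕎.:= c 𝕎.:* (d 𝕎.:* (x 𝕎.:- y)))
                        𝕎.refl (cst a) (∂ G) F F′ ⟩
        mulPS (cst a) (mulPS (∂ G) Δ) 𝕎.∎
      ∂Δ≈0 : ∀ n → (∀ m → m ≤ n → Δ m ≈ 0#) → ∂ Δ n ≈ 0#
      ∂Δ≈0 n Δ≤n≈0 = begin
        ∂ Δ n                               ≈⟨ sym (*-identityʳ _) ⟩
        ∂ Δ n * 1#                          ≈⟨ *-congˡ (sym (trans (reflexive (≡.cong G (ℕP.n∸n≡0 n))) G0≈1)) ⟩
        ∂ Δ n * G (n ∸ n)                   ≈⟨ sym (sumTo-last n _ (λ k k<n →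
                                                 trans (*-congʳ (trans (*-congˡ (Δ≤n≈0 (suc k) k<n)) (zeroʳ _))) (zeroˡ _))) ⟩
        sumTo n (λ k → ∂ Δ k * G (n ∸ k))   ≈⟨ mulPS-comm (∂ Δ) G n ⟩
        mulPS G (∂ Δ) n                     ≈⟨ odeΔ n ⟩
        mulPS (cst a) (mulPS (∂ G) Δ) n     ≈⟨ mulPS-cstˡ a (mulPS (∂ G) Δ) n ⟩
        a * mulPS (∂ G) Δ n                 ≈⟨ *-congˡ (sumTo-0# n _ (λ k _ → trans (*-congˡ (Δ≤n≈0 (n ∸ k) (ℕP.m∸n≤m n k))) (zeroʳ _))) ⟩
        a * 0#                              ≈⟨ zeroʳ _ ⟩
        0# ∎

module MaxInsertion where
  open ≡ using (refl; cong; cong₂; sym; trans; subst; module ≡-Reasoning)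

  AllBelow : ℕ → List ℕ → Set
  AllBelow x σ = All (_< x) σ

  <ᵇ-true : ∀ {y x} → y < x → (y <ᵇ x) ≡ true
  <ᵇ-true {zero} {suc x} _ = refl
  <ᵇ-true {suc y} {suc x} (s≤s y<x) = <ᵇ-true y<x

  <ᵇ-false : ∀ {y x} → y < x → (x <ᵇ y) ≡ false
  <ᵇ-false {zero} {suc x} _ = refl
  <ᵇ-false {suc y} {suc x} (s≤s y<x) = <ᵇ-false y<x

  <ᵇ-irrefl : ∀ z → (z <ᵇ z) ≡ false
  <ᵇ-irrefl zero = refl
  <ᵇ-irrefl (suc z) = <ᵇ-irrefl z

  <ᵇ-asym : ∀ w z → (w <ᵇ z) ≡ true → (z <ᵇ w) ≡ false
  <ᵇ-asym zero (suc z) _ = refl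
  <ᵇ-asym (suc w) (suc z) w<z = <ᵇ-asym w z w<z

  b2n≤1 : ∀ b → b2n b ≤ 1
  b2n≤1 true = s≤s z≤n
  b2n≤1 false = z≤n

  middleInsertions : ℕ → List ℕ → List (List ℕ)
  middleInsertions x [] = []
  middleInsertions x (y ∷ []) = []
  middleInsertions x (y ∷ z ∷ zs) = (y ∷ x ∷ z ∷ zs) ∷ map (y ∷_) (middleInsertions x (z ∷ zs))

  insertions-split : ∀ x y ys →
    insertions x (y ∷ ys) ≡ (x ∷ y ∷ ys) ∷ (middleInsertions x (y ∷ ys) ++ ((y ∷ ys) ++ x ∷ []) ∷ [])
  insertions-split x y [] = refl
  insertions-split x y (z ∷ zs) =
    trans (cong (λ τs → (x ∷ y ∷ z ∷ zs) ∷ map (y ∷_) τs) (insertions-split x z zs))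
          (cong (λ τs → (x ∷ y ∷ z ∷ zs) ∷ (y ∷ x ∷ z ∷ zs) ∷ τs) (ListP.map-++ (y ∷_) (middleInsertions x (z ∷ zs)) _))

  middleInsertions-head : ∀ x z zs → All (λ τ → ∃₂ λ w ρ → τ ≡ z ∷ w ∷ ρ) (middleInsertions x (z ∷ zs))
  middleInsertions-head x z [] = []
  middleInsertions-head x z (w ∷ ws) =
    (x , (w ∷ ws) , refl) ∷ map⁺ (All.map (λ { (w′ , ρ , eq) → w , (w′ ∷ ρ) , cong (z ∷_) eq }) (middleInsertions-head x w ws))

  allB-skip : ∀ (p : ℕ → Bool) x pre suf → p x ≡ true → allB p (pre ++ x ∷ suf) ≡ allB p (pre ++ suf)
  allB-skip p x [] suf px rewrite px = refl
  allB-skip p x (a ∷ pre) suf px = cong (p a ∧_) (allB-skip p x pre suf px)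

  allB-middle : ∀ (p : ℕ → Bool) x ys → p x ≡ true → All (λ τ → allB p τ ≡ allB p ys) (middleInsertions x ys)
  allB-middle p x [] px = []
  allB-middle p x (y ∷ []) px = []
  allB-middle p x (y ∷ z ∷ zs) px =
    allB-skip p x (y ∷ []) (z ∷ zs) px ∷ map⁺ (All.map (cong (p y ∧_)) (allB-middle p x (z ∷ zs) px))

  lrminAux-skip : ∀ x pre seen σ → AllBelow x σ → lrminAux (pre ++ x ∷ seen) σ ≡ lrminAux (pre ++ seen) σ
  lrminAux-skip x pre seen [] _ = refl
  lrminAux-skip x pre seen (y ∷ σ) (y<x ∷ σ<x) =
    cong₂ _+ℕ_ (cong b2n (allB-skip (y <ᵇ_) x pre seen (<ᵇ-true y<x))) (lrminAux-skip x (y ∷ pre) seen σ σ<x)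

  LRmin-front : ∀ x σ → AllBelow x σ → LRmin (x ∷ σ) ≡ suc (LRmin σ)
  LRmin-front x σ σ<x = cong suc (lrminAux-skip x [] [] σ σ<x)

  RLmin-front : ∀ x y ys → y < x → RLmin (x ∷ y ∷ ys) ≡ RLmin (y ∷ ys)
  RLmin-front x y ys y<x rewrite <ᵇ-false y<x = refl

  peaks-front : ∀ x y ys → y < x → peaks (x ∷ y ∷ ys) ≡ peaks (y ∷ ys)
  peaks-front x y [] _ = refl
  peaks-front x y (z ∷ zs) y<x rewrite <ᵇ-false y<x = refl

  lrminAux-end : ∀ x seen y ys → AllBelow x (y ∷ ys) → lrminAux seen ((y ∷ ys) ++ x ∷ []) ≡ lrminAux seen (y ∷ ys)
  lrminAux-end x seen y [] (y<x ∷ []) rewrite <ᵇ-false y<x = refl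
  lrminAux-end x seen y (z ∷ zs) (_ ∷ zs<x) = cong (b2n (allB (y <ᵇ_) seen) +ℕ_) (lrminAux-end x (y ∷ seen) z zs zs<x)

  RLmin-end : ∀ x σ → AllBelow x σ → RLmin (σ ++ x ∷ []) ≡ suc (RLmin σ)
  RLmin-end x [] _ = refl
  RLmin-end x (y ∷ ys) (y<x ∷ ys<x) = trans
    (cong₂ _+ℕ_ (cong b2n (trans (allB-skip (y <ᵇ_) x ys [] (<ᵇ-true y<x)) (cong (allB (y <ᵇ_)) (ListP.++-identityʳ ys))))
                (RLmin-end x ys ys<x))
    (ℕP.+-suc _ _)

  peaks-end : ∀ x σ → AllBelow x σ → peaks (σ ++ x ∷ []) ≡ peaks σ
  peaks-end x [] _ = refl
  peaks-end x (a ∷ []) _ = refl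
  peaks-end x (a ∷ b ∷ []) (_ ∷ b<x ∷ []) rewrite <ᵇ-false b<x | BoolP.∧-zeroʳ (a <ᵇ b) = refl
  peaks-end x (a ∷ b ∷ c ∷ σ) (_ ∷ σ<x) = cong (b2n ((a <ᵇ b) ∧ (c <ᵇ b)) +ℕ_) (peaks-end x (b ∷ c ∷ σ) σ<x)

  RLmin-nonempty : ∀ z zs → Σ ℕ λ m → RLmin (z ∷ zs) ≡ suc m
  RLmin-nonempty z [] = 0 , refl
  RLmin-nonempty z (w ∷ ws) with RLmin-nonempty w ws
  ... | m , eq = b2n (allB (z <ᵇ_) (w ∷ ws)) +ℕ m , trans (cong (b2n (allB (z <ᵇ_) (w ∷ ws)) +ℕ_) eq) (ℕP.+-suc _ _)

  lrminAux-middle : ∀ x seen ys → AllBelow x ys → All (λ τ → lrminAux seen τ ≡ lrminAux seen ys) (middleInsertions x ys)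
  lrminAux-middle x seen [] _ = []
  lrminAux-middle x seen (y ∷ []) _ = []
  lrminAux-middle x seen (y ∷ z ∷ zs) (y<x ∷ zs<x) =
    first ∷ map⁺ (All.map (cong (b2n (allB (y <ᵇ_) seen) +ℕ_)) (lrminAux-middle x (y ∷ seen) (z ∷ zs) zs<x))
    where
      first : lrminAux seen (y ∷ x ∷ z ∷ zs) ≡ lrminAux seen (y ∷ z ∷ zs)
      first rewrite <ᵇ-false y<x = cong (b2n (allB (y <ᵇ_) seen) +ℕ_) (lrminAux-skip x [] (y ∷ seen) (z ∷ zs) zs<x)

  RLmin-middle : ∀ x ys → AllBelow x ys → All (λ τ → RLmin τ ≡ RLmin ys) (middleInsertions x ys)
  RLmin-middle x [] _ = []
  RLmin-middle x (y ∷ []) _ = []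
  RLmin-middle x (y ∷ z ∷ zs) (y<x ∷ zs<x@(z<x ∷ _)) =
    first ∷ map⁺ (All.zipWith (λ (eq , eq′) → cong₂ _+ℕ_ (cong b2n eq) eq′)
                    (allB-middle (y <ᵇ_) x (z ∷ zs) (<ᵇ-true y<x) , RLmin-middle x (z ∷ zs) zs<x))
    where
      first : RLmin (y ∷ x ∷ z ∷ zs) ≡ RLmin (y ∷ z ∷ zs)
      first rewrite <ᵇ-true y<x = cong (b2n (allB (y <ᵇ_) (z ∷ zs)) +ℕ_) (RLmin-front x z zs z<x)

  peakAt : ℕ → ℕ → List ℕ → ℕ
  peakAt a z [] = 0
  peakAt a z (w ∷ _) = b2n ((a <ᵇ z) ∧ (w <ᵇ z))

  peaks-∷ : ∀ a z zs → peaks (a ∷ z ∷ zs) ≡ peakAt a z zs +ℕ peaks (z ∷ zs)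
  peaks-∷ a z [] = refl
  peaks-∷ a z (w ∷ ws) = refl

  peakAt-self : ∀ z zs → peakAt z z zs ≡ 0
  peakAt-self z [] = refl
  peakAt-self z (w ∷ ws) rewrite <ᵇ-irrefl z = refl

  peaks-dup : ∀ z zs → peaks (z ∷ z ∷ zs) ≡ peaks (z ∷ zs)
  peaks-dup z zs = trans (peaks-∷ z z zs) (cong (_+ℕ peaks (z ∷ zs)) (peakAt-self z zs))

  peakAt-adjacent≤1 : ∀ a z w ws → peakAt a z (w ∷ ws) +ℕ peakAt z w ws ≤ 1
  peakAt-adjacent≤1 a z w ws with w <ᵇ z in w<z
  ... | true = subst (_≤ 1) (sym (cong (b2n ((a <ᵇ z) ∧ true) +ℕ_) (second ws)))
                 (subst (_≤ 1) (sym (ℕP.+-identityʳ _)) (b2n≤1 _))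
    where
      second : ∀ ws → peakAt z w ws ≡ 0
      second [] = refl
      second (v ∷ vs) rewrite <ᵇ-asym w z w<z = refl
  ... | false rewrite BoolP.∧-zeroʳ (a <ᵇ z) = second ws
    where
      second : ∀ ws → peakAt z w ws ≤ 1
      second [] = z≤n
      second (v ∷ vs) = b2n≤1 _

  peaks-insert-after : ∀ a x z w ws → z < x → w < x → peaks (a ∷ z ∷ x ∷ w ∷ ws) ≡ suc (peaks (w ∷ ws))
  peaks-insert-after a x z w ws z<x w<x
    rewrite <ᵇ-false z<x | <ᵇ-true z<x | <ᵇ-true w<x | BoolP.∧-zeroʳ (a <ᵇ z) = cong suc (peaks-front x w ws w<x)

  peaks-middle-context : ∀ x a z w ws → All (λ τ → peaks (a ∷ z ∷ τ) ≡ peakAt a z (w ∷ ws) +ℕ peaks (z ∷ τ))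
                                             (middleInsertions x (w ∷ ws))
  peaks-middle-context x a z w ws = All.map (λ { (w′ , ρ , refl) → refl }) (middleInsertions-head x w ws)

  peaks-middle-dup : ∀ x z zs → All (λ τ → peaks (z ∷ τ) ≡ peaks τ) (middleInsertions x (z ∷ zs))
  peaks-middle-dup x z zs = All.map (λ { (w , ρ , refl) → peaks-dup z (w ∷ ρ) }) (middleInsertions-head x z zs)

  gapsNearPeak gapsAwayFromPeak : ℕ → List ℕ → ℕ
  gapsNearPeak a [] = 0
  gapsNearPeak a (z ∷ []) = 0
  gapsNearPeak a (z ∷ w ∷ ws) = gapsNearPeak z (w ∷ ws) +ℕ (peakAt a z (w ∷ ws) +ℕ peakAt z w ws)
  gapsAwayFromPeak a [] = 0
  gapsAwayFromPeak a (z ∷ []) = 0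
  gapsAwayFromPeak a (z ∷ w ∷ ws) = gapsAwayFromPeak z (w ∷ ws) +ℕ (1 ∸ (peakAt a z (w ∷ ws) +ℕ peakAt z w ws))

  open import Data.Nat.Solver using (module +-*-Solver)

  gapsNearPeak-peaks : ∀ a z zs → gapsNearPeak a (z ∷ zs) +ℕ peakAt a z zs ≡ 2 *ℕ peaks (a ∷ z ∷ zs)
  gapsNearPeak-peaks a z [] = refl
  gapsNearPeak-peaks a z (w ∷ ws) = begin
    (A +ℕ (p +ℕ q)) +ℕ p   ≡⟨ solve 3 (λ A p q → (A :+ (p :+ q)) :+ p := (A :+ q) :+ (p :+ p)) refl A p q ⟩
    (A +ℕ q) +ℕ (p +ℕ p)   ≡⟨ cong (_+ℕ (p +ℕ p)) (gapsNearPeak-peaks z w ws) ⟩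
    2 *ℕ K +ℕ (p +ℕ p)     ≡⟨ solve 2 (λ K p → con 2 :* K :+ (p :+ p) := con 2 :* (p :+ K)) refl K p ⟩
    2 *ℕ (p +ℕ K) ∎
    where
      open ≡-Reasoning
      open +-*-Solver
      A = gapsNearPeak z (w ∷ ws)
      p = peakAt a z (w ∷ ws)
      q = peakAt z w ws
      K = peaks (z ∷ w ∷ ws)

  gapsNearPeak-self : ∀ z zs → gapsNearPeak z (z ∷ zs) ≡ 2 *ℕ peaks (z ∷ zs)
  gapsNearPeak-self z zs = begin
    gapsNearPeak z (z ∷ zs)                    ≡⟨ sym (ℕP.+-identityʳ _) ⟩
    gapsNearPeak z (z ∷ zs) +ℕ 0               ≡⟨ cong (gapsNearPeak z (z ∷ zs) +ℕ_) (sym (peakAt-self z zs)) ⟩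
    gapsNearPeak z (z ∷ zs) +ℕ peakAt z z zs   ≡⟨ gapsNearPeak-peaks z z zs ⟩
    2 *ℕ peaks (z ∷ z ∷ zs)                    ≡⟨ cong (2 *ℕ_) (peaks-dup z zs) ⟩
    2 *ℕ peaks (z ∷ zs) ∎
    where open ≡-Reasoning

  gaps-total : ∀ a z zs → gapsNearPeak a (z ∷ zs) +ℕ gapsAwayFromPeak a (z ∷ zs) ≡ length zs
  gaps-total a z [] = refl
  gaps-total a z (w ∷ ws) = begin
    (A +ℕ s) +ℕ (B +ℕ (1 ∸ s))   ≡⟨ solve 4 (λ A B s t → (A :+ s) :+ (B :+ t) := (A :+ B) :+ (s :+ t)) refl A B s (1 ∸ s) ⟩
    (A +ℕ B) +ℕ (s +ℕ (1 ∸ s))   ≡⟨ cong₂ _+ℕ_ (gaps-total z w ws) (ℕP.m+[n∸m]≡n (peakAt-adjacent≤1 a z w ws)) ⟩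
    length ws +ℕ 1               ≡⟨ ℕP.+-comm (length ws) 1 ⟩
    suc (length ws) ∎
    where
      open ≡-Reasoning
      open +-*-Solver
      A = gapsNearPeak z (w ∷ ws)
      B = gapsAwayFromPeak z (w ∷ ws)
      s = peakAt a z (w ∷ ws) +ℕ peakAt z w ws

  insertions-length : ∀ x σ → All (λ τ → length τ ≡ suc (length σ)) (insertions x σ)
  insertions-length x [] = refl ∷ []
  insertions-length x (y ∷ ys) = refl ∷ map⁺ (All.map (cong suc) (insertions-length x ys))

  insertions-below : ∀ x y σ → x < y → AllBelow y σ → All (AllBelow y) (insertions x σ)
  insertions-below x y [] x<y _ = (x<y ∷ []) ∷ []
  insertions-below x y (z ∷ zs) x<y (z<y ∷ zs<y) =
    (x<y ∷ z<y ∷ zs<y) ∷ map⁺ (All.map (z<y ∷_) (insertions-below x y zs x<y zs<y))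

  perms-shape : ∀ m → All (λ σ → length σ ≡ m × AllBelow (suc m) σ) (perms m)
  perms-shape zero = (refl , []) ∷ []
  perms-shape (suc m) = concat⁺ (map⁺ (All.map insert-max (perms-shape m)))
    where
      insert-max : ∀ {σ} → length σ ≡ m × AllBelow (suc m) σ →
                   All (λ τ → length τ ≡ suc m × AllBelow (suc (suc m)) τ) (insertions (suc m) σ)
      insert-max {σ} (len , σ<m+1) = All.zipWith (λ (eq , τ<m+2) → trans eq (cong suc len) , τ<m+2)
        (insertions-length (suc m) σ , insertions-below (suc m) (suc (suc m)) σ ℕP.≤-refl (All.map ℕP.m<n⇒m<1+n σ<m+1))

  2*peaks≤length : ∀ z zs → 2 *ℕ peaks (z ∷ zs) ≤ length zs
  2*peaks≤length z zs = subst (_≤ length zs) (gapsNearPeak-self z zs) (subst (gapsNearPeak z (z ∷ zs) ≤_) (gaps-total z z zs)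
                          (ℕP.m≤m+n (gapsNearPeak z (z ∷ zs)) (gapsAwayFromPeak z (z ∷ zs))))

  gapsAwayFromPeak-self : ∀ z zs → gapsAwayFromPeak z (z ∷ zs) ≡ length zs ∸ 2 *ℕ peaks (z ∷ zs)
  gapsAwayFromPeak-self z zs = trans (sym (ℕP.m+n∸m≡n A (gapsAwayFromPeak z (z ∷ zs))))
                                     (cong₂ _∸_ (gaps-total z z zs) (gapsNearPeak-self z zs))
    where A = gapsNearPeak z (z ∷ zs)

module InsertionSums {c ℓ} (S : CommutativeRing c ℓ) (invS : ℕ → CommutativeRing.Carrier S) where
  open CommutativeRing S
  open PowerSeries S invS
  open MaxInsertion
  open IntegerSolver S using (solve; _:+_; _:*_; _:=_; con)
  open SetoidReasoning setoid

  split-by-bit : ∀ (g : ℕ → Carrier) s P → s ≤ 1 → g (suc P) ≈ ιℕ s * g (s +ℕ P) + ιℕ (1 ∸ s) * g (suc (s +ℕ P))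
  split-by-bit g zero P z≤n = solve 2 (λ a b → b := con (ℤ.+ 0) :* a :+ (con (ℤ.+ 1) :+ con (ℤ.+ 0)) :* b) refl _ _
  split-by-bit g (suc zero) P (s≤s z≤n) = solve 2 (λ a b → a := (con (ℤ.+ 1) :+ con (ℤ.+ 0)) :* a :+ con (ℤ.+ 0) :* b) refl _ _

  middle-peaks-sum-context : ∀ x a z zs → AllBelow x (z ∷ zs) → ∀ (g : ℕ → Carrier) →
    sumList (map (λ τ → g (peaks (a ∷ τ))) (middleInsertions x (z ∷ zs)))
      ≈ ιℕ (gapsNearPeak a (z ∷ zs)) * g (peaks (a ∷ z ∷ zs))
        + ιℕ (gapsAwayFromPeak a (z ∷ zs)) * g (suc (peaks (a ∷ z ∷ zs)))
  middle-peaks-sum-context x a z [] _ g = sym (trans (+-cong (zeroˡ _) (zeroˡ _)) (+-identityʳ _))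
  middle-peaks-sum-context x a z (w ∷ ws) (z<x ∷ ws<x@(w<x ∷ _)) g = begin
    g (peaks (a ∷ z ∷ x ∷ w ∷ ws)) + sumList (map (λ τ → g (peaks (a ∷ τ))) (map (z ∷_) M))
      ≈⟨ +-cong (reflexive (≡.cong g (peaks-insert-after a x z w ws z<x w<x)))
                (reflexive (≡.cong sumList (≡.sym (ListP.map-∘ M)))) ⟩
    g (suc P) + sumList (map (λ τ → g (peaks (a ∷ z ∷ τ))) M)
      ≈⟨ +-congˡ (sumList-cong-All M (All.map (λ eq → reflexive (≡.cong g eq)) (peaks-middle-context x a z w ws))) ⟩
    g (suc P) + sumList (map (λ τ → g′ (peaks (z ∷ τ))) M)
      ≈⟨ +-cong (split-by-bit g s P (peakAt-adjacent≤1 a z w ws)) (middle-peaks-sum-context x z w ws ws<x g′) ⟩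
    (ιℕ s * g (s +ℕ P) + ιℕ (1 ∸ s) * g (suc (s +ℕ P))) + (ιℕ A * g′ K′ + ιℕ B * g′ (suc K′))
      ≈⟨ reflexive (≡.cong₂ (λ i j → (ιℕ s * g i + ιℕ (1 ∸ s) * g (suc i)) + (ιℕ A * g K + ιℕ B * g j))
                            s+P≡K (ℕP.+-suc p K′)) ⟩
    (ιℕ s * g K + ιℕ (1 ∸ s) * g (suc K)) + (ιℕ A * g K + ιℕ B * g (suc K))
      ≈⟨ solve 6 (λ a b c d x y → (a :* x :+ b :* y) :+ (c :* x :+ d :* y) := (c :+ a) :* x :+ (d :+ b) :* y) refl _ _ _ _ _ _ ⟩
    (ιℕ A + ιℕ s) * g K + (ιℕ B + ιℕ (1 ∸ s)) * g (suc K)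
      ≈⟨ sym (+-cong (*-congʳ (ιℕ-+ A s)) (*-congʳ (ιℕ-+ B (1 ∸ s)))) ⟩
    ιℕ (A +ℕ s) * g K + ιℕ (B +ℕ (1 ∸ s)) * g (suc K) ∎
    where
      M = middleInsertions x (w ∷ ws)
      p = peakAt a z (w ∷ ws)
      s = p +ℕ peakAt z w ws
      P = peaks (w ∷ ws)
      K′ = peaks (z ∷ w ∷ ws)
      K = peaks (a ∷ z ∷ w ∷ ws)
      A = gapsNearPeak z (w ∷ ws)
      B = gapsAwayFromPeak z (w ∷ ws)
      g′ : ℕ → Carrier
      g′ j = g (p +ℕ j)
      s+P≡K : s +ℕ P ≡ K
      s+P≡K = ≡.trans (ℕP.+-assoc p _ P) (≡.cong (p +ℕ_) (≡.sym (peaks-∷ z w ws)))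

  -- Repeating the first entry creates no peak, so z serves as its own left context.
  middle-peaks-sum : ∀ x z zs → AllBelow x (z ∷ zs) → ∀ (g : ℕ → Carrier) →
    sumList (map (λ τ → g (peaks τ)) (middleInsertions x (z ∷ zs)))
      ≈ ιℕ (2 *ℕ peaks (z ∷ zs)) * g (peaks (z ∷ zs)) + ιℕ (length zs ∸ 2 *ℕ peaks (z ∷ zs)) * g (suc (peaks (z ∷ zs)))
  middle-peaks-sum x z zs σ<x g = begin
    sumList (map (λ τ → g (peaks τ)) (middleInsertions x (z ∷ zs)))
      ≈⟨ sumList-cong-All _ (All.map (λ eq → reflexive (≡.cong g (≡.sym eq))) (peaks-middle-dup x z zs)) ⟩
    sumList (map (λ τ → g (peaks (z ∷ τ))) (middleInsertions x (z ∷ zs)))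
      ≈⟨ middle-peaks-sum-context x z z zs σ<x g ⟩
    ιℕ (gapsNearPeak z (z ∷ zs)) * g K + ιℕ (gapsAwayFromPeak z (z ∷ zs)) * g (suc K)
      ≈⟨ reflexive (≡.cong₂ (λ A B → ιℕ A * g K + ιℕ B * g (suc K))
                            (gapsNearPeak-self z zs) (gapsAwayFromPeak-self z zs)) ⟩
    ιℕ (2 *ℕ k) * g K + ιℕ (length zs ∸ 2 *ℕ k) * g (suc K)
      ≈⟨ reflexive (≡.cong (λ K → ιℕ (2 *ℕ k) * g K + ιℕ (length zs ∸ 2 *ℕ k) * g (suc K)) (peaks-dup z zs)) ⟩
    ιℕ (2 *ℕ k) * g k + ιℕ (length zs ∸ 2 *ℕ k) * g (suc k) ∎
    where
      k = peaks (z ∷ zs)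
      K = peaks (z ∷ z ∷ zs)

  module Weights (α β Q X : Carrier) where
    minWeight : List ℕ → Carrier
    minWeight σ = pow α (LRmin σ ∸ 1) * pow β (RLmin σ ∸ 1)

    monomial : ℕ → ℕ → Carrier
    monomial k j = pow Q k * pow X j

    peakWeight : ℕ → List ℕ → Carrier
    peakWeight n σ = minWeight σ * monomial (peaks σ) (n ∸ 2 *ℕ peaks σ)

    Dmonomial : ℕ → ℕ → Carrier
    Dmonomial k j = ιℕ (2 *ℕ k) * monomial k (suc j) + ιℕ j * monomial (suc k) (j ∸ 1)

    statWeight : ℕ → ℕ → ℕ → ℕ → Carrier
    statWeight n lr rl k = (pow α (lr ∸ 1) * pow β (rl ∸ 1)) * monomial k (n ∸ 2 *ℕ k)

    peakWeight-stats : ∀ n τ {lr rl k} → LRmin τ ≡ lr → RLmin τ ≡ rl → peaks τ ≡ k → peakWeight n τ ≡ statWeight n lr rl k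
    peakWeight-stats n τ ≡.refl ≡.refl ≡.refl = ≡.refl

    module _ (x z : ℕ) (zs : List ℕ) (σ<x : AllBelow x (z ∷ zs)) (n : ℕ) (len : length zs ≡ n) where
      private
        σ = z ∷ zs
        k = peaks σ
        j = n ∸ 2 *ℕ k
        1+n∸2k≡1+j : suc n ∸ 2 *ℕ k ≡ suc j
        1+n∸2k≡1+j = ℕP.+-∸-assoc 1 (≡.subst (2 *ℕ k ≤_) len (2*peaks≤length z zs))
        1+n∸2[1+k]≡j-1 : suc n ∸ 2 *ℕ suc k ≡ j ∸ 1
        1+n∸2[1+k]≡j-1 = ≡.trans (≡.cong (n ∸_) (≡.trans (ℕP.+-suc k (k +ℕ 0)) (ℕP.+-comm 1 (k +ℕ (k +ℕ 0)))))
                                 (≡.sym (ℕP.∸-+-assoc n (2 *ℕ k) 1))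

      peakWeight-front : peakWeight (suc n) (x ∷ σ) ≈ α * minWeight σ * monomial k (suc j)
      peakWeight-front = begin
        peakWeight (suc n) (x ∷ σ)
          ≡⟨ peakWeight-stats (suc n) (x ∷ σ) (LRmin-front x σ σ<x) (RLmin-front x z zs z<x) (peaks-front x z zs z<x) ⟩
        (α * pow α (LRmin σ ∸ 1) * pow β (RLmin σ ∸ 1)) * monomial k (suc n ∸ 2 *ℕ k)
          ≡⟨ ≡.cong (λ e → (α * pow α (LRmin σ ∸ 1) * pow β (RLmin σ ∸ 1)) * monomial k e) 1+n∸2k≡1+j ⟩
        (α * pow α (LRmin σ ∸ 1) * pow β (RLmin σ ∸ 1)) * monomial k (suc j)
          ≈⟨ *-congʳ (*-assoc α _ _) ⟩
        α * minWeight σ * monomial k (suc j) ∎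
        where z<x = All.head σ<x

      peakWeight-end : peakWeight (suc n) (σ ++ x ∷ []) ≈ β * minWeight σ * monomial k (suc j)
      peakWeight-end = begin
        peakWeight (suc n) (σ ++ x ∷ [])
          ≡⟨ peakWeight-stats (suc n) (σ ++ x ∷ []) (lrminAux-end x [] z zs σ<x) (RLmin-end x σ σ<x) (peaks-end x σ σ<x) ⟩
        (pow α (LRmin σ ∸ 1) * pow β (suc (RLmin σ) ∸ 1)) * monomial k (suc n ∸ 2 *ℕ k)
          ≡⟨ ≡.cong₂ (λ b e → (pow α (LRmin σ ∸ 1) * b) * monomial k e) (pow-suc-pred (proj₂ (RLmin-nonempty z zs))) 1+n∸2k≡1+j ⟩
        (pow α (LRmin σ ∸ 1) * (β * pow β (RLmin σ ∸ 1))) * monomial k (suc j)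
          ≈⟨ *-congʳ (solve 3 (λ a b c → a :* (b :* c) := b :* (a :* c)) refl _ _ _) ⟩
        β * minWeight σ * monomial k (suc j) ∎
        where
          pow-suc-pred : ∀ {r m} → r ≡ suc m → pow β r ≡ β * pow β (r ∸ 1)
          pow-suc-pred ≡.refl = ≡.refl

      peakWeight-middle : sumList (map (peakWeight (suc n)) (middleInsertions x σ)) ≈ minWeight σ * Dmonomial k j
      peakWeight-middle = begin
        sumList (map (peakWeight (suc n)) (middleInsertions x σ))
          ≈⟨ sumList-cong-All _ (All.zipWith (λ { {τ} (lr , rl) → reflexive (peakWeight-stats (suc n) τ lr rl ≡.refl) })
                                              (lrminAux-middle x [] σ σ<x , RLmin-middle x σ σ<x)) ⟩
        sumList (map (λ τ → minWeight σ * g (peaks τ)) (middleInsertions x σ))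
          ≈⟨ sym (sumList-*ˡ (minWeight σ) (λ τ → g (peaks τ)) (middleInsertions x σ)) ⟩
        minWeight σ * sumList (map (λ τ → g (peaks τ)) (middleInsertions x σ))
          ≈⟨ *-congˡ (middle-peaks-sum x z zs σ<x g) ⟩
        minWeight σ * (ιℕ (2 *ℕ k) * g k + ιℕ (length zs ∸ 2 *ℕ k) * g (suc k))
          ≡⟨ ≡.cong (λ m → minWeight σ * (ιℕ (2 *ℕ k) * g k + ιℕ (m ∸ 2 *ℕ k) * g (suc k))) len ⟩
        minWeight σ * (ιℕ (2 *ℕ k) * g k + ιℕ j * g (suc k))
          ≡⟨ ≡.cong₂ (λ e e′ → minWeight σ * (ιℕ (2 *ℕ k) * monomial k e + ιℕ (n ∸ 2 *ℕ k) * monomial (suc k) e′))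
                     1+n∸2k≡1+j 1+n∸2[1+k]≡j-1 ⟩
        minWeight σ * Dmonomial k j ∎
        where
          g : ℕ → Carrier
          g m = monomial m (suc n ∸ 2 *ℕ m)

      insertions-peakWeight : sumList (map (peakWeight (suc n)) (insertions x σ))
                              ≈ ((α + β) * X) * peakWeight n σ + minWeight σ * Dmonomial k j
      insertions-peakWeight = begin
        sumList (map W (insertions x σ))
          ≡⟨ ≡.cong (λ τs → sumList (map W τs)) (insertions-split x z zs) ⟩
        W (x ∷ σ) + sumList (map W (middleInsertions x σ ++ (σ ++ x ∷ []) ∷ []))
          ≈⟨ +-congˡ (trans (reflexive (≡.cong sumList (ListP.map-++ W (middleInsertions x σ) _))) (sumList-++ (map W (middleInsertions x σ)) _)) ⟩
        W (x ∷ σ) + (sumList (map W (middleInsertions x σ)) + (W (σ ++ x ∷ []) + 0#))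
          ≈⟨ +-cong peakWeight-front (+-cong peakWeight-middle (+-congʳ peakWeight-end)) ⟩
        α * minWeight σ * (pow Q k * (X * pow X j))
          + (minWeight σ * Dmonomial k j + (β * minWeight σ * (pow Q k * (X * pow X j)) + 0#))
          ≈⟨ solve 7 (λ a b x m q y d → a :* m :* (q :* (x :* y)) :+ (m :* d :+ (b :* m :* (q :* (x :* y)) :+ con (ℤ.+ 0)))
                                        := ((a :+ b) :* x) :* (m :* (q :* y)) :+ m :* d)
                     refl α β X (minWeight σ) (pow Q k) (pow X j) (Dmonomial k j) ⟩
        ((α + β) * X) * peakWeight n σ + minWeight σ * Dmonomial k j ∎
        where
          W = peakWeight (suc n)

module PeakRecurrence {c ℓ} (R : CommutativeRing c ℓ) (inv : ℕ → CommutativeRing.Carrier R)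
                      (α β u v : CommutativeRing.Carrier R) where
  private module R = CommutativeRing R
  open PowerSeries R inv using (PS; cst; seriesRing; invPS)
  open FormalDerivative R inv using (∂; ∂-isDerivation; ∂-cst)
  open CommutativeRing seriesRing
  open Series seriesRing invPS using (pow; ιℕ; sumList)
  open PowerSeries seriesRing invPS using (ιℕ-+; sumList-concatMap; sumList-cong-All; sumList-cong; sumList-+; sumList-*ˡ)
  open Derivation seriesRing invPS
  open IntegerSolver seriesRing using (solve; _:+_; _:*_; _:-_; :-_; _:=_; con)
  open SetoidReasoning setoid

  s² : R.Carrier
  s² = v R.* v R.- u R.* u

  X : PS
  X zero = v
  X (suc zero) = R.1#
  X (suc (suc _)) = R.0#

  Q : PS
  Q = X * X - cst s²

  D : PS → PS
  D f = Q * ∂ f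

  D-isDerivation : IsDerivation D
  D-isDerivation = *-isDerivation Q ∂-isDerivation
  open IsDerivation D-isDerivation renaming (δ-cong to D-cong; δ-+ to D-+; δ-* to D-*)

  D-cst : ∀ a → D (cst a) ≈ 0#
  D-cst a = trans (*-congˡ {Q} (∂-cst a)) (zeroʳ Q)

  D-X : D X ≈ Q
  D-X = trans (*-congˡ {Q} ∂X≈1) (*-identityʳ Q)
    where
      ∂X≈1 : ∂ X ≈ 1#
      ∂X≈1 zero = R.trans (R.*-identityʳ _) (R.+-identityʳ _)
      ∂X≈1 (suc n) = R.zeroʳ _

  D-Q : D Q ≈ Q * X + X * Q
  D-Q = begin
    D (X * X - cst s²)                  ≈⟨ D-+ (X * X) (- cst s²) ⟩
    D (X * X) + D (- cst s²)            ≈⟨ +-cong (D-* X X) (trans (δ-neg (cst s²)) (-‿cong (D-cst s²))) ⟩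
    (D X * X + X * D X) + - 0#          ≈⟨ +-cong (+-cong (*-congʳ {X} D-X) (*-congˡ {X} D-X)) -0#≈0# ⟩
    (Q * X + X * Q) + 0#                ≈⟨ +-identityʳ _ ⟩
    Q * X + X * Q ∎
    where open import Algebra.Properties.Ring ring using (-0#≈0#)

  D-pow-Q : ∀ k → D (pow Q k) ≈ ιℕ (2 *ℕ k) * (X * pow Q k)
  D-pow-Q zero = trans δ-1# (sym (zeroˡ (X * 1#)))
  D-pow-Q (suc k) = begin
    D (pow Q (suc k))                            ≈⟨ δ-pow Q k ⟩
    ιℕ (suc k) * pow Q k * D Q                   ≈⟨ *-congˡ D-Q ⟩
    ιℕ (suc k) * pow Q k * (Q * X + X * Q)
      ≈⟨ solve 4 (λ i p q x → i :* p :* (q :* x :+ x :* q) := (i :+ i) :* (x :* (q :* p))) refl (ιℕ (suc k)) (pow Q k) Q X ⟩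
    (ιℕ (suc k) + ιℕ (suc k)) * (X * pow Q (suc k))
      ≈⟨ *-congʳ {X * pow Q (suc k)} (sym (trans (ιℕ-+ (suc k) (suc k +ℕ 0))
                                                  (+-congˡ {ιℕ (suc k)} (reflexive (≡.cong ιℕ (ℕP.+-identityʳ (suc k))))))) ⟩
    ιℕ (2 *ℕ suc k) * (X * pow Q (suc k)) ∎

  D-pow-X : ∀ j → D (pow X j) ≈ ιℕ j * (Q * pow X (j ∸ 1))
  D-pow-X zero = trans δ-1# (sym (zeroˡ (Q * 1#)))
  D-pow-X (suc j) = begin
    D (pow X (suc j))               ≈⟨ δ-pow X j ⟩
    ιℕ (suc j) * pow X j * D X      ≈⟨ *-congˡ D-X ⟩
    ιℕ (suc j) * pow X j * Q        ≈⟨ solve 3 (λ i p q → i :* p :* q := i :* (q :* p)) refl (ιℕ (suc j)) (pow X j) Q ⟩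
    ιℕ (suc j) * (Q * pow X j) ∎

  open InsertionSums seriesRing invPS using (module Weights)
  open Weights (cst α) (cst β) Q X public

  D-monomial : ∀ k j → D (monomial k j) ≈ Dmonomial k j
  D-monomial k j = begin
    D (pow Q k * pow X j)
      ≈⟨ D-* (pow Q k) (pow X j) ⟩
    D (pow Q k) * pow X j + pow Q k * D (pow X j)
      ≈⟨ +-cong (*-congʳ {pow X j} (D-pow-Q k)) (*-congˡ {pow Q k} (D-pow-X j)) ⟩
    ιℕ (2 *ℕ k) * (X * pow Q k) * pow X j + pow Q k * (ιℕ j * (Q * pow X (j ∸ 1)))
      ≈⟨ solve 7 (λ a x p y b q z → a :* (x :* p) :* y :+ p :* (b :* (q :* z)) := a :* (p :* (x :* y)) :+ b :* ((q :* p) :* z))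
                 refl (ιℕ (2 *ℕ k)) X (pow Q k) (pow X j) (ιℕ j) Q (pow X (j ∸ 1)) ⟩
    Dmonomial k j ∎

  D-peakWeight : ∀ n σ → D (peakWeight n σ) ≈ minWeight σ * Dmonomial (peaks σ) (n ∸ 2 *ℕ peaks σ)
  D-peakWeight n σ = trans (δ-*-constantˡ (minWeight σ) (monomial k (n ∸ 2 *ℕ k)) D-minWeight≈0)
                           (*-congˡ {minWeight σ} (D-monomial k (n ∸ 2 *ℕ k)))
    where
      k = peaks σ
      D-minWeight≈0 : D (minWeight σ) ≈ 0#
      D-minWeight≈0 = δ-*-constant (pow (cst α) (LRmin σ ∸ 1)) (pow (cst β) (RLmin σ ∸ 1))
                        (δ-pow-constant (cst α) (LRmin σ ∸ 1) (D-cst α)) (δ-pow-constant (cst β) (RLmin σ ∸ 1) (D-cst β))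

  peakSum : ℕ → PS
  peakSum n = sumList (map (peakWeight n) (perms (suc n)))

  peakSum-suc : ∀ n → peakSum (suc n) ≈ ((cst α + cst β) * X) * peakSum n + D (peakSum n)
  peakSum-suc n = begin
    sumList (map (peakWeight (suc n)) (concatMap (insertions (suc (suc n))) σs))
      ≈⟨ sumList-concatMap (peakWeight (suc n)) (insertions (suc (suc n))) σs ⟩
    sumList (map (λ σ → sumList (map (peakWeight (suc n)) (insertions (suc (suc n)) σ))) σs)
      ≈⟨ sumList-cong-All σs (All.map insert-max (MaxInsertion.perms-shape (suc n))) ⟩
    sumList (map (λ σ → ((cst α + cst β) * X) * peakWeight n σ + minWeight σ * Dmonomial (peaks σ) (n ∸ 2 *ℕ peaks σ)) σs)
      ≈⟨ sumList-+ _ _ σs ⟩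
    sumList (map (λ σ → ((cst α + cst β) * X) * peakWeight n σ) σs)
      + sumList (map (λ σ → minWeight σ * Dmonomial (peaks σ) (n ∸ 2 *ℕ peaks σ)) σs)
      ≈⟨ +-cong (sym (sumList-*ˡ _ (peakWeight n) σs)) (sumList-cong σs (λ σ → sym (D-peakWeight n σ))) ⟩
    ((cst α + cst β) * X) * peakSum n + sumList (map (λ σ → D (peakWeight n σ)) σs)
      ≈⟨ +-congˡ (sym (δ-sumList (peakWeight n) σs)) ⟩
    ((cst α + cst β) * X) * peakSum n + D (peakSum n) ∎
    where
      σs = perms (suc n)
      insert-max : ∀ {σ} → length σ ≡.≡ suc n × MaxInsertion.AllBelow (suc (suc n)) σ →
        sumList (map (peakWeight (suc n)) (insertions (suc (suc n)) σ))
          ≈ ((cst α + cst β) * X) * peakWeight n σ + minWeight σ * Dmonomial (peaks σ) (n ∸ 2 *ℕ peaks σ)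
      insert-max {z ∷ zs} (len , σ<n+2) = insertions-peakWeight (suc (suc n)) z zs σ<n+2 n (ℕP.suc-injective len)

  bracketNumerator : ℕ → PS
  bracketNumerator zero = 1#
  bracketNumerator (suc zero) = - X
  bracketNumerator (suc (suc n)) = cst s² * bracketNumerator n

  bracketNumerator-suc : ∀ n → bracketNumerator (suc n) ≈ D (bracketNumerator n) - X * bracketNumerator n
  bracketNumerator-suc zero = begin
    - X                  ≈⟨ solve 1 (λ x → :- x := con (ℤ.+ 0) :- x :* con (ℤ.+ 1)) refl X ⟩
    0# - X * 1#          ≈⟨ +-congʳ (sym δ-1#) ⟩
    D 1# - X * 1# ∎
  bracketNumerator-suc (suc zero) = begin
    cst s² * 1#                     ≈⟨ solve 2 (λ x s → s :* con (ℤ.+ 1) := :- (x :* x :- s) :- x :* (:- x)) refl X (cst s²) ⟩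
    - Q - X * - X                   ≈⟨ +-congʳ (sym (trans (δ-neg X) (-‿cong D-X))) ⟩
    D (- X) - X * - X ∎
  bracketNumerator-suc (suc (suc n)) = begin
    cst s² * bracketNumerator (suc n)                  ≈⟨ *-congˡ (bracketNumerator-suc n) ⟩
    cst s² * (D b - X * b)                             ≈⟨ solve 4 (λ s d x b → s :* (d :- x :* b) := s :* d :- x :* (s :* b)) refl (cst s²) (D b) X b ⟩
    cst s² * D b - X * (cst s² * b)                    ≈⟨ +-congʳ (sym (δ-*-constantˡ (cst s²) b (D-cst s²))) ⟩
    D (cst s² * b) - X * (cst s² * b) ∎
    where b = bracketNumerator n

module BivariateSeries {c ℓ} (R : CommutativeRing c ℓ) (inv : ℕ → CommutativeRing.Carrier R)
                      (inv-correct : PowerSeries.InvertsPositiveIntegers R inv)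
                      (α β u v : CommutativeRing.Carrier R) where
  private module R = CommutativeRing R
  open PowerSeries R inv using (PS; cst; seriesRing; invPS; scalePS; mulPS-cstˡ)
  open ExpLog R inv inv-correct using (ιℕ-suc-*-scalePS-inv-suc!; invPS-correct)
  open PeakRecurrence R inv α β u v
  private module 𝕎 where
    open CommutativeRing seriesRing public
    open IntegerSolver seriesRing public using (solve; _:+_; _:*_; _:-_; _:=_; con)
    open SetoidReasoning (CommutativeRing.setoid seriesRing) public
    open Derivation seriesRing invPS public using (module IsDerivation)
    open IsDerivation D-isDerivation public using (δ-cong; δ-0#; δ-1#; δ-*-constantˡ)
  open PowerSeries seriesRing invPS using (sumTo-0#) renaming (seriesRing to 𝕋; cst to constₜ; mulPS-cstˡ to constₜ-*)
  open FormalDerivative seriesRing invPS using (coefficientwise; ∂-coefficientwise-comm; module SeriesDerivation)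
    renaming (∂ to ∂ₜ; ∂-isDerivation to ∂ₜ-isDerivation; ∂-cst to ∂ₜ-constₜ)
  open ExpLog seriesRing invPS invPS-correct using (vanishing-from-∂)
  open CommutativeRing 𝕋
  open SetoidReasoning setoid

  γ : R.Carrier
  γ = α R.+ β

  D̂ : Carrier → Carrier
  D̂ f n = D (f n)

  X̂ γ̂ : Carrier
  X̂ = constₜ X
  γ̂ = constₜ (cst γ)

  F G : Carrier
  F n = scalePS (inv (n !)) (peakSum n)
  G n = scalePS (inv (n !)) (bracketNumerator n)

  scalePS≈cst* : ∀ a f → scalePS a f 𝕎.≈ cst a 𝕎.* f
  scalePS≈cst* a f = 𝕎.sym (mulPS-cstˡ a f)

  D-scalePS : ∀ a f → D (scalePS a f) 𝕎.≈ cst a 𝕎.* D f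
  D-scalePS a f = 𝕎.trans (𝕎.δ-cong (scalePS≈cst* a f)) (𝕎.δ-*-constantˡ (cst a) f (D-cst a))

  constₜ-*-constₜ : ∀ a b → constₜ a * constₜ b ≈ constₜ (a 𝕎.* b)
  constₜ-*-constₜ a b = trans (constₜ-* a (constₜ b)) λ { zero → 𝕎.refl ; (suc n) → 𝕎.zeroʳ a }

  X̂*γ̂*-at : ∀ f n → (X̂ * γ̂ * f) n 𝕎.≈ (X 𝕎.* cst γ) 𝕎.* f n
  X̂*γ̂*-at f = trans (*-congʳ {f} (constₜ-*-constₜ X (cst γ))) (constₜ-* (X 𝕎.* cst γ) f)

  ∂ₜ-F : ∂ₜ F ≈ X̂ * γ̂ * F + D̂ F
  ∂ₜ-F n = 𝕎.begin
    ιℕₜ (suc n) 𝕎.* F (suc n)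
      𝕎.≈⟨ ιℕ-suc-*-scalePS-inv-suc! n (peakSum (suc n)) ⟩
    scalePS (inv (n !)) (peakSum (suc n))
      𝕎.≈⟨ 𝕎.trans (scalePS≈cst* _ _) (𝕎.*-congˡ {i} (peakSum-suc n)) ⟩
    i 𝕎.* (((cst α 𝕎.+ cst β) 𝕎.* X) 𝕎.* peakSum n 𝕎.+ D (peakSum n))
      𝕎.≈⟨ 𝕎.*-congˡ {i} (𝕎.+-congʳ {D (peakSum n)} (𝕎.*-congʳ {peakSum n} (𝕎.*-congʳ {X} cstα+cstβ≈cstγ))) ⟩
    i 𝕎.* ((cst γ 𝕎.* X) 𝕎.* peakSum n 𝕎.+ D (peakSum n))
      𝕎.≈⟨ 𝕎.solve 5 (λ i g x p d → i 𝕎.:* ((g 𝕎.:* x) 𝕎.:* p 𝕎.:+ d) 𝕎.:= (x 𝕎.:* g) 𝕎.:* (i 𝕎.:* p) 𝕎.:+ i 𝕎.:* d)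
                    𝕎.refl i (cst γ) X (peakSum n) (D (peakSum n)) ⟩
    (X 𝕎.* cst γ) 𝕎.* (i 𝕎.* peakSum n) 𝕎.+ i 𝕎.* D (peakSum n)
      𝕎.≈⟨ 𝕎.+-cong (𝕎.*-congˡ {X 𝕎.* cst γ} (𝕎.sym (scalePS≈cst* (inv (n !)) (peakSum n))))
                    (𝕎.sym (D-scalePS (inv (n !)) (peakSum n))) ⟩
    (X 𝕎.* cst γ) 𝕎.* F n 𝕎.+ D (F n)
      𝕎.≈⟨ 𝕎.+-congʳ {D (F n)} (𝕎.sym (X̂*γ̂*-at F n)) ⟩
    (X̂ * γ̂ * F) n 𝕎.+ D̂ F n 𝕎.∎
    where
      open Series seriesRing invPS using () renaming (ιℕ to ιℕₜ)
      i = cst (inv (n !))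
      cstα+cstβ≈cstγ : cst α 𝕎.+ cst β 𝕎.≈ cst γ
      cstα+cstβ≈cstγ zero = R.refl
      cstα+cstβ≈cstγ (suc n) = R.+-identityʳ R.0#

  ∂ₜ-G : ∂ₜ G ≈ D̂ G - X̂ * G
  ∂ₜ-G n = 𝕎.begin
    ιℕₜ (suc n) 𝕎.* G (suc n)
      𝕎.≈⟨ ιℕ-suc-*-scalePS-inv-suc! n (bracketNumerator (suc n)) ⟩
    scalePS (inv (n !)) (bracketNumerator (suc n))
      𝕎.≈⟨ 𝕎.trans (scalePS≈cst* _ _) (𝕎.*-congˡ {i} (bracketNumerator-suc n)) ⟩
    i 𝕎.* (D b 𝕎.- X 𝕎.* b)
      𝕎.≈⟨ 𝕎.solve 4 (λ i d x b → i 𝕎.:* (d 𝕎.:- x 𝕎.:* b) 𝕎.:= i 𝕎.:* d 𝕎.:- x 𝕎.:* (i 𝕎.:* b)) 𝕎.refl i (D b) X b ⟩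
    i 𝕎.* D b 𝕎.- X 𝕎.* (i 𝕎.* b)
      𝕎.≈⟨ 𝕎.+-cong (𝕎.sym (D-scalePS (inv (n !)) b)) (𝕎.-‿cong (𝕎.*-congˡ {X} (𝕎.sym (scalePS≈cst* (inv (n !)) b)))) ⟩
    D (G n) 𝕎.- X 𝕎.* G n
      𝕎.≈⟨ 𝕎.+-congˡ {D (G n)} (𝕎.-‿cong (𝕎.sym (constₜ-* X G n))) ⟩
    D̂ G n 𝕎.- (X̂ * G) n 𝕎.∎
    where
      open Series seriesRing invPS using () renaming (ιℕ to ιℕₜ)
      i = cst (inv (n !))
      b = bracketNumerator n

  D̂-isDerivation : SeriesDerivation.IsDerivation D̂
  D̂-isDerivation = coefficientwise D-isDerivation

  D̂γ̂≈0 : D̂ γ̂ ≈ 0#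
  D̂γ̂≈0 zero = D-cst γ
  D̂γ̂≈0 (suc n) = 𝕎.δ-0#

  open SeriesDerivation.Defect ∂ₜ-isDerivation D̂-isDerivation (∂-coefficientwise-comm D-isDerivation)
         X̂ γ̂ F G (∂ₜ-constₜ X) (∂ₜ-constₜ (cst γ)) D̂γ̂≈0 ∂ₜ-F ∂ₜ-G public

  defect-0 : defect 0 𝕎.≈ 𝕎.0#
  defect-0 = 𝕎.begin
    G 0 𝕎.* ∂ₜ F 0 𝕎.+ cst γ 𝕎.* (∂ₜ G 0 𝕎.* F 0)
      𝕎.≈⟨ 𝕎.+-cong (𝕎.*-cong G0≈1 (∂ₜ-F 0)) (𝕎.*-congˡ {cst γ} (𝕎.*-cong (∂ₜ-G 0) F0≈1)) ⟩
    𝕎.1# 𝕎.* ((X 𝕎.* cst γ) 𝕎.* F 0 𝕎.+ D (F 0)) 𝕎.+ cst γ 𝕎.* ((D (G 0) 𝕎.- X 𝕎.* G 0) 𝕎.* 𝕎.1#)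
      𝕎.≈⟨ 𝕎.+-cong (𝕎.*-congˡ {𝕎.1#} (𝕎.+-cong (𝕎.*-congˡ {X 𝕎.* cst γ} F0≈1) (𝕎.trans (𝕎.δ-cong F0≈1) 𝕎.δ-1#)))
                    (𝕎.*-congˡ {cst γ} (𝕎.*-congʳ {𝕎.1#}
                       (𝕎.+-cong (𝕎.trans (𝕎.δ-cong G0≈1) 𝕎.δ-1#) (𝕎.-‿cong (𝕎.*-congˡ {X} G0≈1))))) ⟩
    𝕎.1# 𝕎.* ((X 𝕎.* cst γ) 𝕎.* 𝕎.1# 𝕎.+ 𝕎.0#) 𝕎.+ cst γ 𝕎.* ((𝕎.0# 𝕎.- X 𝕎.* 𝕎.1#) 𝕎.* 𝕎.1#)
      𝕎.≈⟨ 𝕎.solve 2 (λ x g → 𝕎.con (ℤ.+ 1) 𝕎.:* ((x 𝕎.:* g) 𝕎.:* 𝕎.con (ℤ.+ 1) 𝕎.:+ 𝕎.con (ℤ.+ 0))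
                              𝕎.:+ g 𝕎.:* ((𝕎.con (ℤ.+ 0) 𝕎.:- x 𝕎.:* 𝕎.con (ℤ.+ 1)) 𝕎.:* 𝕎.con (ℤ.+ 1)) 𝕎.:= 𝕎.con (ℤ.+ 0))
                    𝕎.refl X (cst γ) ⟩
    𝕎.0# 𝕎.∎
    where
      open ExpLog R inv inv-correct using (inv-1)
      G0≈1 : G 0 𝕎.≈ 𝕎.1#
      G0≈1 m = R.trans (R.*-congʳ inv-1) (R.*-identityˡ _)
      F0≈1 : F 0 𝕎.≈ 𝕎.1#
      F0≈1 m = R.trans (R.*-congʳ inv-1) (R.trans (R.*-identityˡ _) (peakSum-0 m))
        where
          peakSum-0 : peakSum 0 𝕎.≈ 𝕎.1#
          peakSum-0 = 𝕎.solve 0 ((𝕎.con (ℤ.+ 1) 𝕎.:* 𝕎.con (ℤ.+ 1)) 𝕎.:* (𝕎.con (ℤ.+ 1) 𝕎.:* 𝕎.con (ℤ.+ 1)) 𝕎.:+ 𝕎.con (ℤ.+ 0)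
                                  𝕎.:= 𝕎.con (ℤ.+ 1)) 𝕎.refl

  defect-vanishes : defect ≈ 0#
  defect-vanishes = vanishing-from-∂ defect defect-0 ∂ₜ-defect≈0
    where
      ∂ₜ-defect≈0 : ∀ n → (∀ m → m ≤ n → defect m 𝕎.≈ 𝕎.0#) → ∂ₜ defect n 𝕎.≈ 𝕎.0#
      ∂ₜ-defect≈0 n defect≤n≈0 = 𝕎.begin
        ∂ₜ defect n
          𝕎.≈⟨ ∂-defect n ⟩
        D (defect n) 𝕎.+ sumTo n (λ k → K k 𝕎.* defect (n ∸ k))
          𝕎.≈⟨ 𝕎.+-cong (𝕎.trans (𝕎.δ-cong (defect≤n≈0 n ℕP.≤-refl)) 𝕎.δ-0#)
                        (sumTo-0# n _ (λ k _ → 𝕎.trans (𝕎.*-congˡ {K k} (defect≤n≈0 (n ∸ k) (ℕP.m∸n≤m n k))) (𝕎.zeroʳ (K k)))) ⟩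
        𝕎.0# 𝕎.+ 𝕎.0#
          𝕎.≈⟨ 𝕎.+-identityʳ 𝕎.0# ⟩
        𝕎.0# 𝕎.∎
        where
          open Series seriesRing invPS using (sumTo)
          K = (γ̂ - 1#) * X̂

module Evaluation {c ℓ} (R : CommutativeRing c ℓ) (inv : ℕ → CommutativeRing.Carrier R)
                  (inv-correct : PowerSeries.InvertsPositiveIntegers R inv)
                  (α β u v : CommutativeRing.Carrier R) where
  open CommutativeRing R
  open PowerSeries R inv
  open FormalDerivative R inv using (∂; ∂-cong)
  open ExpLog R inv inv-correct using (inv-1; cancel-inv-!)
  open IntegerSolver R using (solve; _:+_; _:*_; _:-_; :-_; _:=_; con)
  open SetoidReasoning setoid
  open PeakRecurrence R inv α β u v using (s²; X; Q; bracketNumerator; peakWeight)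
  open BivariateSeries R inv inv-correct α β u v using (γ; γ̂; F; G; defect; defect-vanishes)
  open FormalDerivative seriesRing invPS using () renaming (∂ to ∂ₜ)
  private
    module 𝕎 = Series seriesRing invPS
    module 𝕋 = CommutativeRing (PowerSeries.seriesRing seriesRing invPS)

  at0 : (ℕ → PS) → PS
  at0 f k = f k 0

  𝕎-sumTo-at0 : ∀ n (f : ℕ → PS) → 𝕎.sumTo n f 0 ≈ sumTo n (λ k → f k 0)
  𝕎-sumTo-at0 zero f = refl
  𝕎-sumTo-at0 (suc n) f = +-congʳ (𝕎-sumTo-at0 n f)

  𝕎-sumList-at0 : ∀ {A : Set} (f : A → PS) xs → 𝕎.sumList (map f xs) 0 ≈ sumList (map (λ a → f a 0) xs)
  𝕎-sumList-at0 f [] = refl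
  𝕎-sumList-at0 f (a ∷ xs) = +-congˡ (𝕎-sumList-at0 f xs)

  𝕎-pow-at0 : ∀ f k → 𝕎.pow f k 0 ≈ pow (f 0) k
  𝕎-pow-at0 f zero = refl
  𝕎-pow-at0 f (suc k) = *-congˡ (𝕎-pow-at0 f k)

  at0-* : ∀ f g → at0 (f 𝕋.* g) ≋ mulPS (at0 f) (at0 g)
  at0-* f g n = 𝕎-sumTo-at0 n (λ k → mulPS (f k) (g (n ∸ k)))

  at0-∂ₜ : ∀ f → at0 (∂ₜ f) ≋ ∂ (at0 f)
  at0-∂ₜ f n = *-congʳ (ιℕ-seriesRing (suc n) 0)

  peakWeight-at0 : ∀ n σ → peakWeight n σ 0 ≈ weight α β u v n σ
  peakWeight-at0 n σ = begin
    (𝕎.pow (cst α) a 0 * 𝕎.pow (cst β) b 0) * (𝕎.pow Q k 0 * 𝕎.pow X j 0)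
      ≈⟨ *-cong (*-cong (𝕎-pow-at0 (cst α) a) (𝕎-pow-at0 (cst β) b))
                (*-cong (trans (𝕎-pow-at0 Q k) (pow-congˡ Q0≈u² k)) (𝕎-pow-at0 X j)) ⟩
    (pow α a * pow β b) * (pow (u * u) k * pow v j)
      ≈⟨ *-congˡ (*-congʳ (sym (pow-double u k))) ⟩
    (pow α a * pow β b) * (pow u (2 *ℕ k) * pow v j)
      ≈⟨ solve 4 (λ a b x y → (a :* b) :* (x :* y) := x :* y :* a :* b) refl _ _ _ _ ⟩
    pow u (2 *ℕ k) * pow v j * pow α a * pow β b ∎
    where
      a = LRmin σ ∸ 1
      b = RLmin σ ∸ 1
      k = peaks σ
      j = n ∸ 2 *ℕ k
      Q0≈u² : Q 0 ≈ u * u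
      Q0≈u² = solve 2 (λ u v → v :* v :+ (:- (v :* v :- u :* u)) := u :* u) refl u v

  F-at0 : at0 F ≋ lhs α β u v
  F-at0 n = begin
    inv (n !) * 𝕎.sumList (map (peakWeight n) (perms (suc n))) 0
      ≈⟨ *-congˡ (trans (𝕎-sumList-at0 (peakWeight n) (perms (suc n))) (sumList-cong (perms (suc n)) (peakWeight-at0 n))) ⟩
    inv (n !) * sumList (map (weight α β u v n) (perms (suc n)))
      ≈⟨ *-comm _ _ ⟩
    lhs α β u v n ∎

  -- Series.bracket splits on the parity b of n inside a where-block; byParity b p i is that case split,
  -- with p the power of s² and i = 1/n!.
  byParity : Bool → Carrier → Carrier → Carrier
  byParity b p i = if b then p * i else - (v * p * i)

  byParity-step : ∀ {b p} n → byParity b p (inv (n !)) ≈ inv (n !) * bracketNumerator n 0 →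
                  byParity b (s² * p) (inv (suc (suc n) !)) ≈ inv (suc (suc n) !) * (s² * bracketNumerator n 0)
  byParity-step {true} {p} n eq = begin
    s² * p * i′                   ≈⟨ *-congʳ (*-congˡ (cancel-inv-! n eq)) ⟩
    s² * bracketNumerator n 0 * i′ ≈⟨ *-comm _ _ ⟩
    i′ * (s² * bracketNumerator n 0) ∎
    where i′ = inv (suc (suc n) !)
  byParity-step {false} {p} n eq = begin
    - (v * (s² * p) * i′)           ≈⟨ solve 4 (λ v s p i → :- (v :* (s :* p) :* i) := i :* (s :* (:- (v :* p)))) refl _ _ _ _ ⟩
    i′ * (s² * - (v * p))
      ≈⟨ *-congˡ (*-congˡ (cancel-inv-! n (trans (solve 3 (λ v p i → (:- (v :* p)) :* i := :- (v :* p :* i)) refl _ _ _) eq))) ⟩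
    i′ * (s² * bracketNumerator n 0) ∎
    where i′ = inv (suc (suc n) !)

  bracket≈ : ∀ n → bracket u v n ≈ inv (n !) * bracketNumerator n 0
  bracket≈ zero = *-comm _ _
  bracket≈ (suc zero) = solve 2 (λ v i → :- (v :* con (ℤ.+ 1) :* i) := i :* (:- v)) refl v (inv 1)
  bracket≈ (suc (suc n)) = byParity-step n (bracket≈ n)

  G-at0 : at0 G ≋ bracket u v
  G-at0 n = sym (bracket≈ n)

  at0-γ̂ : at0 γ̂ ≋ cst γ
  at0-γ̂ zero = refl
  at0-γ̂ (suc n) = refl

  defect-at0 : at0 defect ≋ (mulPS (bracket u v) (∂ (lhs α β u v)) ⊕ scalePS γ (mulPS (∂ (bracket u v)) (lhs α β u v)))
  defect-at0 n = +-cong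
    (trans (at0-* G (∂ₜ F) n) (mulPS-cong G-at0 (λ k → trans (at0-∂ₜ F k) (∂-cong F-at0 k)) n))
    (trans (at0-* γ̂ (∂ₜ G 𝕋.* F) n)
      (trans (mulPS-cong {g = at0 (∂ₜ G 𝕋.* F)} at0-γ̂ (λ _ → refl) n)
        (trans (mulPS-cstˡ γ (at0 (∂ₜ G 𝕋.* F)) n)
          (*-congˡ (trans (at0-* (∂ₜ G) F n) (mulPS-cong (λ k → trans (at0-∂ₜ G k) (∂-cong G-at0 k)) F-at0 n))))))

  lhs-ode : mulPS (bracket u v) (∂ (lhs α β u v)) ≋ mulPS (cst (- γ)) (mulPS (∂ (bracket u v)) (lhs α β u v))
  lhs-ode n = begin
    mulPS B (∂ L) n                                          ≈⟨ solve 2 (λ x y → x := (x :+ y) :- y) refl _ _ ⟩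
    (mulPS B (∂ L) n + γ * mulPS (∂ B) L n) - γ * mulPS (∂ B) L n ≈⟨ +-congʳ (trans (sym (defect-at0 n)) (defect-vanishes n 0)) ⟩
    0# - γ * mulPS (∂ B) L n                                 ≈⟨ solve 2 (λ g m → con (ℤ.+ 0) :- g :* m := (:- g) :* m) refl _ _ ⟩
    - γ * mulPS (∂ B) L n                                    ≈⟨ sym (mulPS-cstˡ (- γ) (mulPS (∂ B) L) n) ⟩
    mulPS (cst (- γ)) (mulPS (∂ B) L) n ∎
    where
      B = bracket u v
      L = lhs α β u v

  bracket-0 : bracket u v 0 ≈ 1#
  bracket-0 = trans (*-identityˡ _) inv-1

  lhs-0≈rhs-0 : lhs α β u v 0 ≈ rhs α β u v 0
  lhs-0≈rhs-0 = solve 1 (λ i → (((con (ℤ.+ 1) :* con (ℤ.+ 1)) :* con (ℤ.+ 1)) :* con (ℤ.+ 1) :+ con (ℤ.+ 0)) :* i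
                             := i :* con (ℤ.+ 1)) refl (inv 1)

mainTheorem17 : ∀ {c ℓ} (R : CommutativeRing c ℓ)
    (inv : ℕ → CommutativeRing.Carrier R) →
    (∀ n → CommutativeRing._≈_ R (CommutativeRing._*_ R (Series.ιℕ R inv (suc n)) (inv (suc n))) (CommutativeRing.1# R)) →
    ∀ (α β u v : CommutativeRing.Carrier R) (n : ℕ) →
    CommutativeRing._≈_ R (Series.lhs R inv α β u v n) (Series.rhs R inv α β u v n)
mainTheorem17 R inv inv-correct α β u v =
  ode-unique (bracket u v) (- (α + β)) (lhs α β u v) (rhs α β u v) bracket-0
             lhs-ode (cpowPS-ode (bracket u v) (- (α + β)) bracket-0) lhs-0≈rhs-0
  where
    open CommutativeRing R using (_+_; -_)
    open Series R inv using (bracket; lhs; rhs)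
    open ExpLog R inv inv-correct using (ode-unique; cpowPS-ode)
    open Evaluation R inv inv-correct α β u v using (bracket-0; lhs-ode; lhs-0≈rhs-0)
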